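{- Let $K=\mathbb{Q}(\sqrt{D})$ where $D\in\mathbb{Z}_{\ge2}$ is squarefree and $D\neq5$, and let $\alpha=(\lceil2\xi_D\rceil+2)+2\omega_D$. (i) If $\lceil\xi_D\rceil-\xi_D>\frac12$, then $p_K(\alpha)=6$. (ii) If $\lceil\xi_D\rceil-\xi_D<\frac12$, then $p_K(\alpha)=9$.
   Context: Let $\omega_D=\sqrt{D}$ and $\xi_D=\sqrt D$ if $D\equiv2,3\pmod4$, and $\omega_D=\frac{1+\sqrt D}{2}$, $\xi_D=\frac{\sqrt D-1}{2}$ if $D\equiv1\pmod4$. $\mathcal{O}_K$ is the ring of integers of $K$ and $\mathcal{O}_K^+$ the set of totally positive elements of $\mathcal{O}_K$ (those $\gamma$ with $\gamma>0$, $\gamma'>0$, $'$ denoting Galois conjugation). A partition of $\alpha\in\mathcal{O}_K^+$ is an expression $\alpha=\alpha_1+\dots+\alpha_n$ with $n\ge1$ and $\alpha_i\in\mathcal{O}_K^+$, order irrelevant; $p_K(\alpha)$ is the number of partitions of $\alpha$. -}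

module Defs where

open import Data.Nat as ℕ using (ℕ; _%_)
open import Data.Nat.Primality using (Prime)
open import Data.Integer as ℤ using (ℤ; +_; _+_; _-_; _*_; _<_; -_)
open import Data.Product using (_×_; _,_; Σ)
open import Data.Sum using (_⊎_)
open import Data.List using (List; []; _∷_; foldr)
open import Data.List.Relation.Unary.All using (All)
open import Data.List.Relation.Binary.Permutation.Propositional using (_↭_)
open import Data.Vec using (Vec; lookup)
open import Data.Fin using (Fin)
open import Relation.Nullary using (¬_)
open import Relation.Binary.PropositionalEquality using (_≡_; _≢_)

SquareFree : ℕ → Set
SquareFree D = ∀ p → Prime p → ¬ (Data.Nat.Divisibility._∣_ (p ℕ.* p) D)
  where import Data.Nat.Divisibility

-- δ D = 1 if D ≡ 1 (mod 4), else 0.   Then ω_D = (δ + √D)/2^δ, ξ_D = ω_D - δ.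
δ' : ℕ → ℤ
δ' 1 = + 1
δ' _ = + 0

δ : ℕ → ℤ
δ D = δ' (D % 4)

-- Elements of O_K, written (a , b) for a + b ω_D  (a, b ∈ ℤ).
OK : Set
OK = ℤ × ℤ

infixl 6 _⊕_ _⊖_
infixr 7 _·_

_⊕_ : OK → OK → OK
(a , b) ⊕ (c , d) = (a + c , b + d)

_⊖_ : OK → OK → OK
(a , b) ⊖ (c , d) = (a - c , b - d)

ι : ℤ → OK
ι n = (n , + 0)

_·_ : ℤ → OK → OK
n · (a , b) = (n * a , n * b)

ω : OK
ω = (+ 0 , + 1)

ξ : ℕ → OK
ξ D = ω ⊖ ι (δ D)

-- "u + v √D > 0" (real, positive square root), for D a positive non-square.
PosSqrt : ℕ → ℤ → ℤ → Set
PosSqrt D u v = (+ 0 < u × v * v * + D < u * u) ⊎ (+ 0 < v × u * u < v * v * + D)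

-- 2^δ (a + b ω_D) = u + v √D with u = 2^δ a + δ b, v = b
uPart : ℕ → OK → ℤ
uPart D (a , b) = a + δ D * a + δ D * b

-- x > 0 in the embedding √D ↦ +√D
Positive : ℕ → OK → Set
Positive D x@(a , b) = PosSqrt D (uPart D x) b

-- x' > 0 (Galois conjugate, √D ↦ -√D)
Positive' : ℕ → OK → Set
Positive' D x@(a , b) = PosSqrt D (uPart D x) (- b)

TotPos : ℕ → OK → Set
TotPos D x = Positive D x × Positive' D x

-- c = ⌈x⌉ for c ∈ ℤ:  c - 1 < x ≤ c  (as real numbers via the first embedding)
IsCeil : ℕ → ℤ → OK → Set
IsCeil D c x = Positive D (x ⊖ ι (c - + 1)) × ¬ Positive D (x ⊖ ι c)

sumOK : List OK → OK
sumOK = foldr _⊕_ (+ 0 , + 0)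

-- a partition of α: nonempty list of totally positive elements summing to α
-- (order is irrelevant: partitions are compared up to permutation _↭_)
IsPartition : ℕ → OK → List OK → Set
IsPartition D α [] = Data.Empty.⊥  where import Data.Empty
IsPartition D α (x ∷ xs) = All (TotPos D) (x ∷ xs) × sumOK (x ∷ xs) ≡ α

-- p_K(α) = n : there are exactly n partitions of α up to reordering,
-- i.e. n representatives, pairwise non-permutations, exhausting all partitions.
PartitionCount : ℕ → OK → ℕ → Set
PartitionCount D α n =
  Σ (Vec (List OK) n) λ P →
    (∀ i → IsPartition D α (lookup P i)) ×
    (∀ i j → lookup P i ↭ lookup P j → i ≡ j) ×
    (∀ xs → IsPartition D α xs → Σ (Fin n) λ i → xs ↭ lookup P i)

-- An element a + bω of O_K is encoded as (a , b); positivity of 2^δ(a + bω) = u + v√D is decided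
-- in ℤ by comparing u² with v²D, and since D is squarefree (so √D is irrational) the positive
-- elements are closed under addition.  Write c = ⌈ξ⌉, c₂ = ⌈2ξ⌉ and α = c₂ + 2 + 2ω.
-- A totally positive summand x of α has ω-coefficient b ≥ 0: otherwise x plus the conjugate of
-- α − x, shifted by a multiple of ω − ω′, is the positive element c₂ + 2 + 3δ − 4ω, which forces
-- 4√D < 5(1 + δ); this fails since D ≥ 2, and D ≥ 13 when D ≡ 1 (mod 4) because D ≠ 5, 9.
-- For b = 0, 1, 2, comparing x′ > 0 with the ceilings gives x = 1 + m, c + m + ω or c₂ + m + 2ω.
-- In case (i) c₂ = 2c − 1 and in case (ii) c₂ = 2c, so a partition of α is either c₂ + m + 2ω
-- plus integers summing to 2 − m (4 partitions), or c + m₁ + ω and c + m₂ + ω plus integers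
-- with m₁ + m₂ + (their sum) = 1 (2 partitions) resp. 2 (5 partitions).

module Submission where

open import Defs
open import Data.Integer using (ℤ; +_; _+_; _-_)
open import Data.Product using (_×_; _,_)
open import Relation.Binary.PropositionalEquality using (_≢_)

open import Data.Nat as ℕ using (ℕ; zero; suc; z≤n; s≤s; _%_; _/_; _^_)
import Data.Nat.Properties as ℕP
import Data.Nat.DivMod as ℕDivMod
open import Data.Nat.Divisibility using (_∣_; divides)
open import Data.Nat.Primality using (Prime; prime?; euclidsLemma; prime⇒nonZero; prime⇒nonTrivial)
open import Data.Nat.Primality.Factorisation using (factorise)
open import Data.Nat.Induction using (<-rec)
open import Data.Nat.ListAction using (sum; product)
open import Data.Nat.ListAction.Properties using (sum-↭)
import Data.Nat.Tactic.RingSolver as ℕRing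
import Data.Integer as ℤ
open import Data.Integer using (+[1+_]; -[1+_]; _*_; -_; _<_; +≤+; +<+; ∣_∣)
import Data.Integer.Properties as ℤP
open import Data.Integer.Tactic.RingSolver using (solve)
open import Data.Fin as Fin using (Fin; splitAt; _↑ˡ_; _↑ʳ_)
import Data.Fin.Properties as FinP
open import Data.Vec using (lookup; tabulate)
open import Data.Vec.Properties using (lookup∘tabulate)
open import Data.List using (List; []; _∷_; map)
import Data.List.Properties as ListP
open import Data.List.Membership.Propositional using (_∈_)
open import Data.List.Relation.Unary.Any using (here; there)
open import Data.List.Relation.Unary.All as All using (All)
import Data.List.Relation.Unary.All.Properties as AllP
open import Data.List.Relation.Binary.Permutation.Propositional as Perm using (_↭_; ↭-refl; ↭-prep; ↭-swap; ↭-trans)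
import Data.List.Relation.Binary.Permutation.Propositional.Properties as PermP
open import Data.Product using (∃; ∃₂; proj₁; proj₂; map₂)
open import Data.Sum using (_⊎_; inj₁; inj₂; [_,_]′)
open import Data.Empty using (⊥; ⊥-elim)
open import Function using (id; _∘_)
open import Relation.Nullary using (¬_; yes; no)
open import Relation.Nullary.Decidable using (Dec; from-yes; _→-dec_)
open import Relation.Binary using (tri<; tri≈; tri>)
open import Relation.Binary.PropositionalEquality
open ≡-Reasoning

module IntegerInequalities where

  open Data.Integer using (_≤_)

  0≤*0≤ : ∀ {a b} → + 0 ≤ a → + 0 ≤ b → + 0 ≤ a * b
  0≤*0≤ {+ m} {+ n} _ _ = subst (+ 0 ≤_) (ℤP.pos-* m n) (+≤+ z≤n)

  0<*0< : ∀ {a b} → + 0 < a → + 0 < b → + 0 < a * b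
  0<*0< {+[1+ m ]} {+[1+ n ]} _ _ = +<+ (s≤s z≤n)
  0<*0< {+ zero} (+<+ ()) _
  0<*0< {+[1+ m ]} {+ zero} _ (+<+ ())

  0≤i*i : ∀ i → + 0 ≤ i * i
  0≤i*i (+ n) = 0≤*0≤ {+ n} (+≤+ z≤n) (+≤+ z≤n)
  0≤i*i -[1+ n ] = +≤+ z≤n

  ≤-by : ∀ {a b} k → + 0 ≤ k → b ≡ a + k → a ≤ b
  ≤-by {a} k 0≤k refl = ℤP.i≤i+j a k {{ℤ.nonNegative 0≤k}}

  <-by : ∀ {a b} k → + 0 < k → b ≡ a + k → a < b
  <-by {a} k 0<k refl = subst (_< a + k) (ℤP.+-identityʳ a) (ℤP.+-monoʳ-< a 0<k)


  0<-diff : ∀ {a b} → a < b → + 0 < b - a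
  0<-diff {a} {b} a<b = subst (_< b - a) (ℤP.+-inverseʳ a) (ℤP.+-monoˡ-< (- a) a<b)

  0<1+i⇒0≤i : ∀ i → + 0 < + 1 + i → + 0 ≤ i
  0<1+i⇒0≤i (+ n) _ = +≤+ z≤n
  0<1+i⇒0≤i -[1+ zero ] (+<+ ())
  0<1+i⇒0≤i -[1+ suc n ] ()

  0<1±i⇒i≡0 : ∀ i → + 0 < + 1 + i → + 0 < + 1 - i → i ≡ + 0
  0<1±i⇒i≡0 i 0<1+i 0<1-i = ℤP.≤-antisym (subst (_≤ + 0) (ℤP.neg-involutive i) (ℤP.neg-mono-≤ (0<1+i⇒0≤i (- i) 0<1-i))) (0<1+i⇒0≤i i 0<1+i)



  *-mono-≤-nonNeg : ∀ {p q r s} → + 0 ≤ p → + 0 ≤ s → p ≤ q → r ≤ s → p * r ≤ q * s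
  *-mono-≤-nonNeg {p} {q} {r} {s} 0≤p 0≤s p≤q r≤s =
    ≤-by ((q - p) * s + p * (s - r)) (ℤP.+-mono-≤ (0≤*0≤ (ℤP.i≤j⇒0≤j-i p≤q) 0≤s) (0≤*0≤ 0≤p (ℤP.i≤j⇒0≤j-i r≤s)))
         (solve (p ∷ q ∷ r ∷ s ∷ []))

  *-self-mono-≤ : ∀ {a b} → + 0 ≤ a → a ≤ b → a * a ≤ b * b
  *-self-mono-≤ 0≤a a≤b = *-mono-≤-nonNeg 0≤a (ℤP.≤-trans 0≤a a≤b) a≤b a≤b

  *-self-mono-< : ∀ {a b} → + 0 ≤ a → a < b → a * a < b * b
  *-self-mono-< {a} {b} 0≤a a<b =
    <-by ((b - a) * ((b - a) + a + a)) (0<*0< (0<-diff a<b) (ℤP.+-mono-<-≤ (ℤP.+-mono-<-≤ (0<-diff a<b) 0≤a) 0≤a))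
         (solve (a ∷ b ∷ []))

  *-self-cancel-≤ : ∀ {a b} → + 0 ≤ b → a * a ≤ b * b → a ≤ b
  *-self-cancel-≤ {a} {b} 0≤b a²≤b² with a ℤP.≤? b
  ... | yes a≤b = a≤b
  ... | no a≰b = ⊥-elim (ℤP.<⇒≱ (*-self-mono-< 0≤b (ℤP.≰⇒> a≰b)) a²≤b²)

  -- Reads: if a₁√X < b₁√Y and a₂√X ≤ b₂√Y then (a₁ + a₂)√X < (b₁ + b₂)√Y.
  +-mono-√-<-≤ : ∀ {a₁ a₂ b₁ b₂ X Y} → + 0 ≤ a₁ → + 0 ≤ a₂ → + 0 ≤ b₁ → + 0 ≤ b₂ → + 0 ≤ X → + 0 ≤ Y →
                 a₁ * a₁ * X < b₁ * b₁ * Y → a₂ * a₂ * X ≤ b₂ * b₂ * Y →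
                 (a₁ + a₂) * (a₁ + a₂) * X < (b₁ + b₂) * (b₁ + b₂) * Y
  +-mono-√-<-≤ {a₁} {a₂} {b₁} {b₂} {X} {Y} 0≤a₁ 0≤a₂ 0≤b₁ 0≤b₂ 0≤X 0≤Y h₁ h₂ =
    <-by ((b₁ * b₁ * Y - a₁ * a₁ * X) + (b₂ * b₂ * Y - a₂ * a₂ * X) + (+ 2 * (b₁ * b₂ * Y - a₁ * a₂ * X)))
         (ℤP.+-mono-<-≤ (ℤP.+-mono-<-≤ (0<-diff h₁) (ℤP.i≤j⇒0≤j-i h₂)) (0≤*0≤ {+ 2} (+≤+ z≤n) (ℤP.i≤j⇒0≤j-i cross)))
         (solve (a₁ ∷ a₂ ∷ b₁ ∷ b₂ ∷ X ∷ Y ∷ []))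
    where
    cross : a₁ * a₂ * X ≤ b₁ * b₂ * Y
    cross = *-self-cancel-≤ (0≤*0≤ (0≤*0≤ 0≤b₁ 0≤b₂) 0≤Y) (subst₂ _≤_ (square a₁ a₂ X) (square b₁ b₂ Y)
              (*-mono-≤-nonNeg (0≤*0≤ (0≤i*i a₁) 0≤X) (0≤*0≤ (0≤i*i b₂) 0≤Y) (ℤP.<⇒≤ h₁) h₂))
      where
      square : ∀ p q Z → (p * p * Z) * (q * q * Z) ≡ (p * q * Z) * (p * q * Z)
      square p q Z = solve (p ∷ q ∷ Z ∷ [])

  <0⊎0≤ : ∀ i → i < + 0 ⊎ + 0 ≤ i
  <0⊎0≤ i with i ℤP.<? + 0
  ... | yes i<0 = inj₁ i<0
  ... | no i≮0 = inj₂ (ℤP.≮⇒≥ i≮0)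



  neg-square : ∀ i → - i * - i ≡ i * i
  neg-square i = solve (i ∷ [])

  0<-of-square : ∀ {u X} → + 0 ≤ u → + 0 ≤ X → X < u * u → + 0 < u
  0<-of-square {+ zero} _ 0≤X X<0 = ⊥-elim (ℤP.<⇒≱ X<0 0≤X)
  0<-of-square {+[1+ n ]} _ _ _ = +<+ (s≤s z≤n)

  0<-of-scaled-square : ∀ {v X Y} → + 0 ≤ v → + 0 ≤ X → X < v * v * Y → + 0 < v
  0<-of-scaled-square {+ zero} _ 0≤X X<0 = ⊥-elim (ℤP.<⇒≱ X<0 0≤X)
  0<-of-scaled-square {+[1+ n ]} _ _ _ = +<+ (s≤s z≤n)

  *-self-antimono-≤ : ∀ {a b} → a ≤ b → b ≤ + 0 → b * b ≤ a * a
  *-self-antimono-≤ {a} {b} a≤b b≤0 =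
    subst₂ _≤_ (neg-square b) (neg-square a) (*-self-mono-≤ (ℤP.neg-mono-≤ b≤0) (ℤP.neg-mono-≤ a≤b))

  ≤-+-nonneg : ∀ {a} b → + 0 ≤ b → a ≤ b + a
  ≤-+-nonneg {a} b 0≤b = ≤-by b 0≤b (ℤP.+-comm b a)

  0≤i-j⇒i≡j+∣i-j∣ : ∀ {i j} → + 0 ≤ i - j → i ≡ j + + ∣ i - j ∣
  0≤i-j⇒i≡j+∣i-j∣ {i} {j} 0≤i-j = begin
    i              ≡⟨ solve (i ∷ j ∷ []) ⟩
    j + (i - j)    ≡⟨ cong (λ t → j + t) (sym (ℤP.0≤i⇒+∣i∣≡i {i - j} 0≤i-j)) ⟩
    j + + ∣ i - j ∣ ∎

  +-cancelˡ-≡ : ∀ i {j k} → i + j ≡ i + k → j ≡ k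
  +-cancelˡ-≡ i {j} {k} i+j≡i+k = begin
    j              ≡⟨ solve (i ∷ j ∷ []) ⟩
    - i + (i + j)  ≡⟨ cong (λ t → - i + t) i+j≡i+k ⟩
    - i + (i + k)  ≡⟨ solve (i ∷ k ∷ []) ⟩
    k              ∎

open IntegerInequalities

-- √D is irrational

prime-divisor : ∀ {n} → 2 ℕ.≤ n → ∃ λ p → Prime p × p ∣ n
prime-divisor {1} (s≤s ())
prime-divisor {n@(suc (suc _))} _ with factorise n
... | record { factors = [] ; isFactorisation = () }
... | record { factors = p ∷ ps ; isFactorisation = n≡Πps ; factorsPrime = p-prime All.∷ _ } =
  p , p-prime , divides (product ps) (trans n≡Πps (ℕP.*-comm p (product ps)))

prime-∣-square : ∀ {p n} → Prime p → p ∣ n ℕ.* n → p ∣ n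
prime-∣-square {n = n} p-prime p∣n² = [ id , id ]′ (euclidsLemma n n p-prime p∣n²)

square-ratio-descent : ∀ {p k} → Prime p → ¬ (p ∣ k) → ∀ {a b} → a ℕ.* a ≡ b ℕ.* b ℕ.* (k ℕ.* p) →
                       ∃₂ λ a′ b′ → b ≡ b′ ℕ.* p × a′ ℕ.* a′ ≡ b′ ℕ.* b′ ℕ.* (k ℕ.* p)
square-ratio-descent {p} {k} p-prime p∤k {a} {b} a²≡b²kp
  with divides a′ refl ← prime-∣-square {n = a} p-prime (divides (b ℕ.* b ℕ.* k) (begin
         a ℕ.* a               ≡⟨ a²≡b²kp ⟩
         b ℕ.* b ℕ.* (k ℕ.* p) ≡⟨ ℕRing.solve (b ∷ k ∷ p ∷ []) ⟩
         b ℕ.* b ℕ.* k ℕ.* p   ∎))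
  with a′²p≡b²k ← ℕP.*-cancelʳ-≡ (a′ ℕ.* a′ ℕ.* p) (b ℕ.* b ℕ.* k) p {{prime⇒nonZero p-prime}} (begin
         a′ ℕ.* a′ ℕ.* p ℕ.* p         ≡⟨ ℕRing.solve (a′ ∷ p ∷ []) ⟩
         a′ ℕ.* p ℕ.* (a′ ℕ.* p)       ≡⟨ a²≡b²kp ⟩
         b ℕ.* b ℕ.* (k ℕ.* p)         ≡⟨ ℕRing.solve (b ∷ k ∷ p ∷ []) ⟩
         b ℕ.* b ℕ.* k ℕ.* p           ∎)
  with divides b′ refl ← prime-∣-square {n = b} p-prime
         ([ id , ⊥-elim ∘ p∤k ]′ (euclidsLemma (b ℕ.* b) k p-prime (divides (a′ ℕ.* a′) (sym a′²p≡b²k))))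
  = a′ , b′ , refl , ℕP.*-cancelʳ-≡ _ _ p {{prime⇒nonZero p-prime}} (begin
         a′ ℕ.* a′ ℕ.* p                       ≡⟨ a′²p≡b²k ⟩
         b′ ℕ.* p ℕ.* (b′ ℕ.* p) ℕ.* k         ≡⟨ ℕRing.solve (b′ ∷ k ∷ p ∷ []) ⟩
         b′ ℕ.* b′ ℕ.* (k ℕ.* p) ℕ.* p         ∎)

squarefree⇒√-irrational : ∀ {D} → 2 ℕ.≤ D → SquareFree D → ∀ a b → a ℕ.* a ≡ b ℕ.* b ℕ.* D → b ≡ 0
squarefree⇒√-irrational {D} 2≤D squarefree with prime-divisor 2≤D
... | p , p-prime , divides k refl = λ a b → <-rec P descend b a
  where
  p∤k : ¬ (p ∣ k)
  p∤k (divides q refl) = squarefree p p-prime (divides q (ℕRing.solve (q ∷ p ∷ [])))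
  P : ℕ → Set
  P b = ∀ a → a ℕ.* a ≡ b ℕ.* b ℕ.* (k ℕ.* p) → b ≡ 0
  descend : ∀ b → (∀ {b′} → b′ ℕ.< b → P b′) → P b
  descend b smaller a a²≡b²D with square-ratio-descent p-prime p∤k {a} {b} a²≡b²D
  ... | _ , zero , refl , _ = refl
  ... | a′ , b′@(suc _) , refl , a′²≡b′²D
    with () ← smaller (ℕP.m<m*n b′ p (ℕ.nonTrivial⇒n>1 p {{prime⇒nonTrivial p-prime}})) a′ a′²≡b′²D

IrrationalSqrt : ℕ → Set
IrrationalSqrt D = ∀ u v → u * u ≡ v * v * + D → v ≡ + 0

squarefree⇒irrationalSqrt : ∀ {D} → 2 ℕ.≤ D → SquareFree D → IrrationalSqrt D
squarefree⇒irrationalSqrt {D} 2≤D squarefree u v u²≡v²D =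
  ℤP.∣i∣≡0⇒i≡0 (squarefree⇒√-irrational 2≤D squarefree ∣ u ∣ ∣ v ∣ (begin
    ∣ u ∣ ℕ.* ∣ u ∣           ≡⟨ ℤP.∣i*j∣≡∣i∣*∣j∣ u u ⟨
    ∣ u * u ∣                 ≡⟨ cong ∣_∣ u²≡v²D ⟩
    ∣ v * v * + D ∣           ≡⟨ ℤP.∣i*j∣≡∣i∣*∣j∣ (v * v) (+ D) ⟩
    ∣ v * v ∣ ℕ.* D           ≡⟨ cong (ℕ._* D) (ℤP.∣i*j∣≡∣i∣*∣j∣ v v) ⟩
    ∣ v ∣ ℕ.* ∣ v ∣ ℕ.* D     ∎))


module √Positivity (D : ℕ) (irrational : IrrationalSqrt D) where

  open Data.Integer using (_≤_)

  0<D : + 0 < + D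
  0<D = ℤP.≤∧≢⇒< (+≤+ z≤n) 0≢D
    where
    0≢D : + 0 ≢ + D
    0≢D 0≡D with () ← irrational (+ 0) (+ 1) (trans 0≡D (sym (ℤP.*-identityˡ (+ D))))

  0≤v²D : ∀ v → + 0 ≤ v * v * + D
  0≤v²D v = 0≤*0≤ (0≤i*i v) (ℤP.<⇒≤ 0<D)

  nonneg⇒PosSqrt : ∀ {u v} → + 0 ≤ u → + 0 ≤ v → + 0 < u + v → PosSqrt D u v
  nonneg⇒PosSqrt {u} {v} 0≤u 0≤v 0<u+v with ℤP.<-cmp (v * v * + D) (u * u)
  ... | tri< N<u² _ _ = inj₁ (0<-of-square 0≤u (0≤v²D v) N<u² , N<u²)
  ... | tri> _ _ u²<N = inj₂ (0<-of-scaled-square 0≤v (0≤i*i u) u²<N , u²<N)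
  ... | tri≈ _ N≡u² _ with refl ← irrational u v (sym N≡u²) =
    ⊥-elim (ℤP.<-irrefl N≡u² (0<*0< 0<u 0<u))
    where
    0<u : + 0 < u
    0<u = subst (+ 0 <_) (ℤP.+-identityʳ u) 0<u+v

  data PositiveForm (u v : ℤ) : Set where
    nonneg  : + 0 ≤ u → + 0 ≤ v → + 0 < u + v → PositiveForm u v
    u-large : + 0 < u → v < + 0 → v * v * + D < u * u → PositiveForm u v
    v-large : u < + 0 → + 0 < v → u * u < v * v * + D → PositiveForm u v

  positiveForm : ∀ {u v} → PosSqrt D u v → PositiveForm u v
  positiveForm {u} {v} (inj₁ (0<u , N<u²)) with <0⊎0≤ v
  ... | inj₁ v<0 = u-large 0<u v<0 N<u²
  ... | inj₂ 0≤v = nonneg (ℤP.<⇒≤ 0<u) 0≤v (ℤP.+-mono-<-≤ 0<u 0≤v)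
  positiveForm {u} {v} (inj₂ (0<v , u²<N)) with <0⊎0≤ u
  ... | inj₁ u<0 = v-large u<0 0<v u²<N
  ... | inj₂ 0≤u = nonneg 0≤u (ℤP.<⇒≤ 0<v) (subst (+ 0 <_) (ℤP.+-comm v u) (ℤP.+-mono-<-≤ 0<v 0≤u))

  nonneg+u-large : ∀ {u₁ v₁ u₂ v₂} → + 0 ≤ u₁ → + 0 ≤ v₁ → + 0 < u₂ → v₂ < + 0 → v₂ * v₂ * + D < u₂ * u₂ →
                   PosSqrt D (u₁ + u₂) (v₁ + v₂)
  nonneg+u-large {u₁} {v₁} {u₂} {v₂} 0≤u₁ 0≤v₁ 0<u₂ v₂<0 N₂<u₂² = by-sign-of-V (<0⊎0≤ (v₁ + v₂))
    where
    0<U : + 0 < u₁ + u₂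
    0<U = subst (+ 0 <_) (ℤP.+-comm u₂ u₁) (ℤP.+-mono-<-≤ 0<u₂ 0≤u₁)
    by-sign-of-V : v₁ + v₂ < + 0 ⊎ + 0 ≤ v₁ + v₂ → PosSqrt D (u₁ + u₂) (v₁ + v₂)
    by-sign-of-V (inj₂ 0≤V) = nonneg⇒PosSqrt (ℤP.<⇒≤ 0<U) 0≤V (ℤP.+-mono-<-≤ 0<U 0≤V)
    by-sign-of-V (inj₁ V<0) = inj₁ (0<U , ℤP.≤-<-trans
      (ℤP.*-monoʳ-≤-nonNeg (+ D) (*-self-antimono-≤ (≤-+-nonneg v₁ 0≤v₁) (ℤP.<⇒≤ V<0)))
      (ℤP.<-≤-trans N₂<u₂² (*-self-mono-≤ (ℤP.<⇒≤ 0<u₂) (≤-+-nonneg u₁ 0≤u₁))))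

  nonneg+v-large : ∀ {u₁ v₁ u₂ v₂} → + 0 ≤ u₁ → + 0 ≤ v₁ → u₂ < + 0 → + 0 < v₂ → u₂ * u₂ < v₂ * v₂ * + D →
                   PosSqrt D (u₁ + u₂) (v₁ + v₂)
  nonneg+v-large {u₁} {v₁} {u₂} {v₂} 0≤u₁ 0≤v₁ u₂<0 0<v₂ u₂²<N₂ = by-sign-of-U (<0⊎0≤ (u₁ + u₂))
    where
    0<V : + 0 < v₁ + v₂
    0<V = subst (+ 0 <_) (ℤP.+-comm v₂ v₁) (ℤP.+-mono-<-≤ 0<v₂ 0≤v₁)
    by-sign-of-U : u₁ + u₂ < + 0 ⊎ + 0 ≤ u₁ + u₂ → PosSqrt D (u₁ + u₂) (v₁ + v₂)
    by-sign-of-U (inj₂ 0≤U) = nonneg⇒PosSqrt 0≤U (ℤP.<⇒≤ 0<V) (subst (+ 0 <_) (ℤP.+-comm (v₁ + v₂) (u₁ + u₂)) (ℤP.+-mono-<-≤ 0<V 0≤U))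
    by-sign-of-U (inj₁ U<0) = inj₂ (0<V , ℤP.≤-<-trans
      (*-self-antimono-≤ (≤-+-nonneg u₁ 0≤u₁) (ℤP.<⇒≤ U<0))
      (ℤP.<-≤-trans u₂²<N₂ (ℤP.*-monoʳ-≤-nonNeg (+ D) (*-self-mono-≤ (ℤP.<⇒≤ 0<v₂) (≤-+-nonneg v₁ 0≤v₁)))))

  u-large+u-large : ∀ {u₁ v₁ u₂ v₂} → + 0 < u₁ → v₁ < + 0 → v₁ * v₁ * + D < u₁ * u₁ →
                    + 0 < u₂ → v₂ < + 0 → v₂ * v₂ * + D < u₂ * u₂ → PosSqrt D (u₁ + u₂) (v₁ + v₂)
  u-large+u-large {u₁} {v₁} {u₂} {v₂} 0<u₁ v₁<0 N₁<u₁² 0<u₂ v₂<0 N₂<u₂² =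
    inj₁ (ℤP.+-mono-<-≤ 0<u₁ (ℤP.<⇒≤ 0<u₂) , subst₂ _<_ (neg-sum-square v₁ v₂ (+ D)) (ℤP.*-identityʳ ((u₁ + u₂) * (u₁ + u₂)))
      (+-mono-√-<-≤ (ℤP.neg-mono-≤ (ℤP.<⇒≤ v₁<0)) (ℤP.neg-mono-≤ (ℤP.<⇒≤ v₂<0)) (ℤP.<⇒≤ 0<u₁) (ℤP.<⇒≤ 0<u₂) (ℤP.<⇒≤ 0<D) (+≤+ z≤n)
        (scale v₁ u₁ N₁<u₁²) (ℤP.<⇒≤ (scale v₂ u₂ N₂<u₂²))))
    where
    scale : ∀ v u → v * v * + D < u * u → - v * - v * + D < u * u * + 1
    scale v u = subst₂ _<_ (cong (_* + D) (sym (neg-square v))) (sym (ℤP.*-identityʳ (u * u)))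
    neg-sum-square : ∀ a b X → (- a + - b) * (- a + - b) * X ≡ (a + b) * (a + b) * X
    neg-sum-square a b X = solve (a ∷ b ∷ X ∷ [])

  v-large+v-large : ∀ {u₁ v₁ u₂ v₂} → u₁ < + 0 → + 0 < v₁ → u₁ * u₁ < v₁ * v₁ * + D →
                    u₂ < + 0 → + 0 < v₂ → u₂ * u₂ < v₂ * v₂ * + D → PosSqrt D (u₁ + u₂) (v₁ + v₂)
  v-large+v-large {u₁} {v₁} {u₂} {v₂} u₁<0 0<v₁ u₁²<N₁ u₂<0 0<v₂ u₂²<N₂ =
    inj₂ (ℤP.+-mono-<-≤ 0<v₁ (ℤP.<⇒≤ 0<v₂) , subst (_< (v₁ + v₂) * (v₁ + v₂) * + D) (neg-sum-square u₁ u₂)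
      (+-mono-√-<-≤ (ℤP.neg-mono-≤ (ℤP.<⇒≤ u₁<0)) (ℤP.neg-mono-≤ (ℤP.<⇒≤ u₂<0)) (ℤP.<⇒≤ 0<v₁) (ℤP.<⇒≤ 0<v₂) (+≤+ z≤n) (ℤP.<⇒≤ 0<D)
        (scale u₁ v₁ u₁²<N₁) (ℤP.<⇒≤ (scale u₂ v₂ u₂²<N₂))))
    where
    scale : ∀ u v → u * u < v * v * + D → - u * - u * + 1 < v * v * + D
    scale u v = subst (_< v * v * + D) (trans (sym (neg-square u)) (sym (ℤP.*-identityʳ (- u * - u))))
    neg-sum-square : ∀ a b → (- a + - b) * (- a + - b) * + 1 ≡ (a + b) * (a + b)
    neg-sum-square a b = solve (a ∷ b ∷ [])

  square-cong : ∀ {x y} X → x ≡ y → x * x * X ≡ y * y * X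
  square-cong X = cong (λ t → t * t * X)

  -- In both lemmas the first summand would be (U , V) minus the second, a sum of two nonpositive elements.
  u-large+v-large≰0 : ∀ {u₁ v₁ u₂ v₂} → v₁ * v₁ * + D < u₁ * u₁ → u₂ < + 0 → + 0 < v₂ → u₂ * u₂ < v₂ * v₂ * + D →
                      + 0 ≤ u₁ + u₂ → + 0 ≤ - (v₁ + v₂) → (u₁ + u₂) * (u₁ + u₂) ≤ (v₁ + v₂) * (v₁ + v₂) * + D → ⊥
  u-large+v-large≰0 {u₁} {v₁} {u₂} {v₂} N₁<u₁² u₂<0 0<v₂ u₂²<N₂ 0≤U 0≤-V U²≤N = ℤP.<-asym N₁<u₁²
    (subst₂ _<_ (trans (square-cong (+ 1) u₁≡) (ℤP.*-identityʳ (u₁ * u₁))) (trans (square-cong (+ D) -v₁≡) (cong (_* + D) (neg-square v₁)))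
      (+-mono-√-<-≤ (ℤP.neg-mono-≤ (ℤP.<⇒≤ u₂<0)) 0≤U (ℤP.<⇒≤ 0<v₂) 0≤-V (+≤+ z≤n) (ℤP.<⇒≤ 0<D)
        (subst₂ _<_ (trans (sym (neg-square u₂)) (sym (ℤP.*-identityʳ _))) refl u₂²<N₂)
        (subst₂ _≤_ (sym (ℤP.*-identityʳ _)) (cong (_* + D) (sym (neg-square (v₁ + v₂)))) U²≤N)))
    where
    u₁≡ : - u₂ + (u₁ + u₂) ≡ u₁
    u₁≡ = solve (u₁ ∷ u₂ ∷ [])
    -v₁≡ : v₂ + - (v₁ + v₂) ≡ - v₁
    -v₁≡ = solve (v₁ ∷ v₂ ∷ [])

  u-large+v-large≱0 : ∀ {u₁ v₁ u₂ v₂} → + 0 < u₁ → v₁ < + 0 → v₁ * v₁ * + D < u₁ * u₁ → u₂ * u₂ < v₂ * v₂ * + D →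
                      + 0 ≤ - (u₁ + u₂) → + 0 ≤ v₁ + v₂ → (v₁ + v₂) * (v₁ + v₂) * + D ≤ (u₁ + u₂) * (u₁ + u₂) → ⊥
  u-large+v-large≱0 {u₁} {v₁} {u₂} {v₂} 0<u₁ v₁<0 N₁<u₁² u₂²<N₂ 0≤-U 0≤V N≤U² = ℤP.<-asym u₂²<N₂
    (subst₂ _<_ (square-cong (+ D) v₂≡) (trans (square-cong (+ 1) -u₂≡) (trans (ℤP.*-identityʳ _) (neg-square u₂)))
      (+-mono-√-<-≤ (ℤP.neg-mono-≤ (ℤP.<⇒≤ v₁<0)) 0≤V (ℤP.<⇒≤ 0<u₁) 0≤-U (ℤP.<⇒≤ 0<D) (+≤+ z≤n)
        (subst₂ _<_ (cong (_* + D) (sym (neg-square v₁))) (sym (ℤP.*-identityʳ _)) N₁<u₁²)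
        (subst₂ _≤_ refl (trans (sym (neg-square (u₁ + u₂))) (sym (ℤP.*-identityʳ _))) N≤U²)))
    where
    v₂≡ : - v₁ + (v₁ + v₂) ≡ v₂
    v₂≡ = solve (v₁ ∷ v₂ ∷ [])
    -u₂≡ : u₁ + - (u₁ + u₂) ≡ - u₂
    -u₂≡ = solve (u₁ ∷ u₂ ∷ [])

  u-large+v-large : ∀ {u₁ v₁ u₂ v₂} → + 0 < u₁ → v₁ < + 0 → v₁ * v₁ * + D < u₁ * u₁ →
                    u₂ < + 0 → + 0 < v₂ → u₂ * u₂ < v₂ * v₂ * + D → PosSqrt D (u₁ + u₂) (v₁ + v₂)
  u-large+v-large {u₁} {v₁} {u₂} {v₂} 0<u₁ v₁<0 N₁<u₁² u₂<0 0<v₂ u₂²<N₂ = by-signs (<0⊎0≤ U) (<0⊎0≤ V)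
    where
    U V : ℤ
    U = u₁ + u₂
    V = v₁ + v₂
    not-u-below : + 0 ≤ U → + 0 ≤ - V → U * U ≤ V * V * + D → ⊥
    not-u-below = u-large+v-large≰0 {u₁} {v₁} N₁<u₁² u₂<0 0<v₂ u₂²<N₂
    not-v-below : + 0 ≤ - U → + 0 ≤ V → V * V * + D ≤ U * U → ⊥
    not-v-below = u-large+v-large≱0 {u₁} {v₁} {u₂} {v₂} 0<u₁ v₁<0 N₁<u₁² u₂²<N₂
    by-signs : U < + 0 ⊎ + 0 ≤ U → V < + 0 ⊎ + 0 ≤ V → PosSqrt D U V
    by-signs (inj₂ 0≤U) (inj₂ 0≤V) with + 0 ℤP.<? U + V
    ... | yes 0<U+V = nonneg⇒PosSqrt 0≤U 0≤V 0<U+V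
    ... | no U+V≯0 = ⊥-elim (not-u-below 0≤U (ℤP.neg-mono-≤ V≤0) (ℤP.≤-trans (*-self-mono-≤ 0≤U U≤0) (0≤v²D V)))
      where
      U≤0 : U ≤ + 0
      U≤0 = ℤP.≤-trans (ℤP.i≤i+j U V {{ℤ.nonNegative 0≤V}}) (ℤP.≮⇒≥ U+V≯0)
      V≤0 : V ≤ + 0
      V≤0 = ℤP.≤-trans (≤-+-nonneg U 0≤U) (ℤP.≮⇒≥ U+V≯0)
    by-signs (inj₂ 0≤U) (inj₁ V<0) with V * V * + D ℤP.<? U * U
    ... | yes N<U² = inj₁ (0<-of-square 0≤U (0≤v²D V) N<U² , N<U²)
    ... | no N≮U² = ⊥-elim (not-u-below 0≤U (ℤP.neg-mono-≤ (ℤP.<⇒≤ V<0)) (ℤP.≮⇒≥ N≮U²))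
    by-signs (inj₁ U<0) (inj₂ 0≤V) with U * U ℤP.<? V * V * + D
    ... | yes U²<N = inj₂ (0<-of-scaled-square 0≤V (0≤i*i U) U²<N , U²<N)
    ... | no U²≮N = ⊥-elim (not-v-below (ℤP.neg-mono-≤ (ℤP.<⇒≤ U<0)) 0≤V (ℤP.≮⇒≥ U²≮N))
    by-signs (inj₁ U<0) (inj₁ V<0) = ⊥-elim (ℤP.<-asym u₂²<N₂ (ℤP.≤-<-trans
      (ℤP.*-monoʳ-≤-nonNeg (+ D) (subst (v₂ * v₂ ≤_) (neg-square v₁) (*-self-mono-≤ (ℤP.<⇒≤ 0<v₂) (≤-by (- V) (ℤP.neg-mono-≤ (ℤP.<⇒≤ V<0)) (minus v₁ v₂)))))
      (ℤP.<-≤-trans N₁<u₁² (subst (u₁ * u₁ ≤_) (neg-square u₂) (*-self-mono-≤ (ℤP.<⇒≤ 0<u₁) (≤-by (- U) (ℤP.neg-mono-≤ (ℤP.<⇒≤ U<0)) (minus′ u₁ u₂)))))))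
      where
      minus : ∀ a b → - a ≡ b + - (a + b)
      minus a b = solve (a ∷ b ∷ [])
      minus′ : ∀ a b → - b ≡ a + - (a + b)
      minus′ a b = solve (a ∷ b ∷ [])

  swap-sum : ∀ {u₁ v₁ u₂ v₂} → PosSqrt D (u₂ + u₁) (v₂ + v₁) → PosSqrt D (u₁ + u₂) (v₁ + v₂)
  swap-sum {u₁} {v₁} {u₂} {v₂} = subst₂ (PosSqrt D) (ℤP.+-comm u₂ u₁) (ℤP.+-comm v₂ v₁)

  form-+ : ∀ {u₁ v₁ u₂ v₂} → PositiveForm u₁ v₁ → PositiveForm u₂ v₂ → PosSqrt D (u₁ + u₂) (v₁ + v₂)
  form-+ {u₁} {v₁} {u₂} {v₂} (nonneg 0≤u₁ 0≤v₁ 0<s₁) (nonneg 0≤u₂ 0≤v₂ 0<s₂) =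
    nonneg⇒PosSqrt (ℤP.+-mono-≤ 0≤u₁ 0≤u₂) (ℤP.+-mono-≤ 0≤v₁ 0≤v₂)
      (<-by ((u₁ + v₁) + (u₂ + v₂)) (ℤP.+-mono-<-≤ 0<s₁ (ℤP.<⇒≤ 0<s₂)) (solve (u₁ ∷ v₁ ∷ u₂ ∷ v₂ ∷ [])))
  form-+ (nonneg a b _) (u-large d e f) = nonneg+u-large a b d e f
  form-+ (nonneg a b _) (v-large d e f) = nonneg+v-large a b d e f
  form-+ (u-large a b c) (u-large d e f) = u-large+u-large a b c d e f
  form-+ (v-large a b c) (v-large d e f) = v-large+v-large a b c d e f
  form-+ (u-large a b c) (v-large d e f) = u-large+v-large a b c d e f
  form-+ {u₁} {v₁} {u₂} {v₂} x@(u-large _ _ _) y@(nonneg _ _ _) = swap-sum {u₁} {v₁} {u₂} {v₂} (form-+ y x)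
  form-+ {u₁} {v₁} {u₂} {v₂} x@(v-large _ _ _) y@(nonneg _ _ _) = swap-sum {u₁} {v₁} {u₂} {v₂} (form-+ y x)
  form-+ {u₁} {v₁} {u₂} {v₂} x@(v-large _ _ _) y@(u-large _ _ _) = swap-sum {u₁} {v₁} {u₂} {v₂} (form-+ y x)

  PosSqrt-+ : ∀ {u₁ v₁ u₂ v₂} → PosSqrt D u₁ v₁ → PosSqrt D u₂ v₂ → PosSqrt D (u₁ + u₂) (v₁ + v₂)
  PosSqrt-+ p q = form-+ (positiveForm p) (positiveForm q)

  PosSqrt-int : ∀ {k} → + 0 < k → PosSqrt D k (+ 0)
  PosSqrt-int 0<k = inj₁ (0<k , 0<*0< 0<k 0<k)

  PosSqrt-int⁻¹ : ∀ {k} → PosSqrt D k (+ 0) → + 0 < k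
  PosSqrt-int⁻¹ (inj₁ (0<k , _)) = 0<k
  PosSqrt-int⁻¹ (inj₂ (+<+ () , _))

  PosSqrt-√D : ∀ {k} → + 0 < k → PosSqrt D (+ 0) k
  PosSqrt-√D 0<k = inj₂ (0<k , 0<*0< (0<*0< 0<k 0<k) 0<D)

  PosSqrt-monoʳ : ∀ {u v k} → + 0 ≤ k → PosSqrt D u v → PosSqrt D u (v + k)
  PosSqrt-monoʳ {u} {v} {+ zero} _ p = subst (PosSqrt D u) (sym (ℤP.+-identityʳ v)) p
  PosSqrt-monoʳ {u} {v} {k@(+[1+ _ ])} _ p = subst (λ t → PosSqrt D t (v + k)) (ℤP.+-identityʳ u) (PosSqrt-+ p (PosSqrt-√D (+<+ (s≤s z≤n))))

  PosSqrt-dichotomy : ∀ {u v} → v ≢ + 0 → PosSqrt D u v ⊎ PosSqrt D (- u) (- v)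
  PosSqrt-dichotomy {u} {v} v≢0 = by-signs (<0⊎0≤ u) (<0⊎0≤ v)
    where
    flip< : ∀ a b → a * a * + D < b * b → - a * - a * + D < - b * - b
    flip< a b = subst₂ _<_ (cong (_* + D) (sym (neg-square a))) (sym (neg-square b))
    flip> : ∀ a b → a * a < b * b * + D → - a * - a < - b * - b * + D
    flip> a b = subst₂ _<_ (sym (neg-square a)) (cong (_* + D) (sym (neg-square b)))
    by-signs : u < + 0 ⊎ + 0 ≤ u → v < + 0 ⊎ + 0 ≤ v → PosSqrt D u v ⊎ PosSqrt D (- u) (- v)
    by-signs (inj₂ 0≤u) (inj₂ 0≤v) = inj₁ (nonneg⇒PosSqrt 0≤u 0≤v (subst (+ 0 <_) (ℤP.+-comm v u) (ℤP.+-mono-<-≤ (ℤP.≤∧≢⇒< 0≤v (≢-sym v≢0)) 0≤u)))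
    by-signs (inj₁ u<0) (inj₁ v<0) = inj₂ (nonneg⇒PosSqrt (ℤP.neg-mono-≤ (ℤP.<⇒≤ u<0)) (ℤP.neg-mono-≤ (ℤP.<⇒≤ v<0)) (ℤP.+-mono-<-≤ (ℤP.neg-mono-< u<0) (ℤP.neg-mono-≤ (ℤP.<⇒≤ v<0))))
    by-signs (inj₂ 0≤u) (inj₁ v<0) with ℤP.<-cmp (v * v * + D) (u * u)
    ... | tri< N<u² _ _ = inj₁ (inj₁ (0<-of-square 0≤u (0≤v²D v) N<u² , N<u²))
    ... | tri≈ _ N≡u² _ = ⊥-elim (v≢0 (irrational u v (sym N≡u²)))
    ... | tri> _ _ u²<N = inj₂ (inj₂ (ℤP.neg-mono-< v<0 , flip> u v u²<N))
    by-signs (inj₁ u<0) (inj₂ 0≤v) with ℤP.<-cmp (v * v * + D) (u * u)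
    ... | tri< N<u² _ _ = inj₂ (inj₁ (ℤP.neg-mono-< u<0 , flip< v u N<u²))
    ... | tri≈ _ N≡u² _ = ⊥-elim (v≢0 (irrational u v (sym N≡u²)))
    ... | tri> _ _ u²<N = inj₁ (inj₂ (ℤP.≤∧≢⇒< 0≤v (≢-sym v≢0) , u²<N))

  PosSqrt-negative-v : ∀ {u v} → PosSqrt D u v → v < + 0 → + 0 < u × v * v * + D < u * u
  PosSqrt-negative-v (inj₁ u-is-large) _ = u-is-large
  PosSqrt-negative-v (inj₂ (0<v , _)) v<0 = ⊥-elim (ℤP.<-asym 0<v v<0)

↭-map-reflect : ∀ {A B : Set} {f : A → B} → (∀ {x y} → f x ≡ f y → x ≡ y) →
                ∀ {xs ys} → map f xs ↭ map f ys → xs ↭ ys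
↭-map-reflect {f = f} f-injective {xs} fxs↭fys with PermP.↭-map-inv f fxs↭fys
... | zs , fys≡fzs , xs↭zs = subst (xs ↭_) (sym (ListP.map-injective f-injective fys≡fzs)) xs↭zs

All-∃⇒map : ∀ {A B : Set} {f : A → B} {ys : List B} → All (λ y → ∃ λ x → y ≡ f x) ys → ∃ λ xs → ys ≡ map f xs
All-∃⇒map All.[] = [] , refl
All-∃⇒map (( x , refl) All.∷ ys) with All-∃⇒map ys
... | xs , refl = x ∷ xs , refl

⊕-comm : ∀ x y → x ⊕ y ≡ y ⊕ x
⊕-comm (a , b) (c , d) = cong₂ _,_ (ℤP.+-comm a c) (ℤP.+-comm b d)

⊕-assoc : ∀ x y z → (x ⊕ y) ⊕ z ≡ x ⊕ (y ⊕ z)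
⊕-assoc (a , b) (c , d) (e , f) = cong₂ _,_ (ℤP.+-assoc a c e) (ℤP.+-assoc b d f)

⊕-identityˡ : ∀ x → (+ 0 , + 0) ⊕ x ≡ x
⊕-identityˡ (a , b) = cong₂ _,_ (ℤP.+-identityˡ a) (ℤP.+-identityˡ b)

⊕-identityʳ : ∀ x → x ⊕ (+ 0 , + 0) ≡ x
⊕-identityʳ (a , b) = cong₂ _,_ (ℤP.+-identityʳ a) (ℤP.+-identityʳ b)

sumOK-↭ : ∀ {xs ys} → xs ↭ ys → sumOK xs ≡ sumOK ys
sumOK-↭ Perm.refl = refl
sumOK-↭ (Perm.prep x p) = cong (x ⊕_) (sumOK-↭ p)
sumOK-↭ {x ∷ y ∷ xs} {.y ∷ .x ∷ ys} (Perm.swap .x .y p) = begin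
  x ⊕ (y ⊕ sumOK xs)   ≡⟨ sym (⊕-assoc x y (sumOK xs)) ⟩
  (x ⊕ y) ⊕ sumOK xs   ≡⟨ cong₂ _⊕_ (⊕-comm x y) (sumOK-↭ p) ⟩
  (y ⊕ x) ⊕ sumOK ys   ≡⟨ ⊕-assoc y x (sumOK ys) ⟩
  y ⊕ (x ⊕ sumOK ys)   ∎
sumOK-↭ (Perm.trans p q) = trans (sumOK-↭ p) (sumOK-↭ q)

-- d plays the role of δ_D ∈ {0, 1}: 2^δ (a + bω) = u[ a , b ] + b√D, conj is the Galois
-- conjugation, and ρ = ω − ω′ = 2^(1−δ) √D.
module Embedding (D : ℕ) (irrational : IrrationalSqrt D)
                 (d : ℤ) (0≤d : + 0 ℤ.≤ d) (d²≡d : d * d ≡ d) where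

  open Data.Integer using (_≤_)

  open √Positivity D irrational

  u[_] : OK → ℤ
  u[ a , b ] = a + d * a + d * b

  conj : OK → OK
  conj (a , b) = (a + d * b , - b)

  ρ : OK
  ρ = (- d , + 2)

  -- A record rather than PosSqrt itself, so that x can be inferred from a proof of IsPos x.
  record IsPos (x : OK) : Set where
    constructor pos
    field unpos : PosSqrt D u[ x ] (proj₂ x)
  open IsPos public

  IsTotPos : OK → Set
  IsTotPos x = IsPos x × IsPos (conj x)

  u-⊕ : ∀ x y → u[ x ⊕ y ] ≡ u[ x ] + u[ y ]
  u-⊕ (a , b) (a′ , b′) = begin
    (a + a′) + d * (a + a′) + d * (b + b′)              ≡⟨ solve (a ∷ b ∷ a′ ∷ b′ ∷ d ∷ []) ⟩
    (a + d * a + d * b) + (a′ + d * a′ + d * b′)        ∎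

  u-conj : ∀ x → u[ conj x ] ≡ u[ x ]
  u-conj (a , b) = begin
    (a + d * b) + d * (a + d * b) + d * - b   ≡⟨ solve (a ∷ b ∷ d ∷ []) ⟩
    a + d * a + (d * d) * b                   ≡⟨ cong (λ t → a + d * a + t * b) d²≡d ⟩
    a + d * a + d * b                         ∎

  u-ρ : ∀ k → u[ k · ρ ] ≡ + 0
  u-ρ k = begin
    k * - d + d * (k * - d) + d * (k * + 2)   ≡⟨ solve (k ∷ d ∷ []) ⟩
    k * (d - d * d)                           ≡⟨ cong (λ t → k * (d - t)) d²≡d ⟩
    k * (d - d)                               ≡⟨ cong (k *_) (ℤP.+-inverseʳ d) ⟩
    k * + 0                                   ≡⟨ ℤP.*-zeroʳ k ⟩
    + 0                                       ∎

  IsPos-⊕ : ∀ {x y} → IsPos x → IsPos y → IsPos (x ⊕ y)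
  IsPos-⊕ {x} {y} (pos x>0) (pos y>0) = pos (subst (λ t → PosSqrt D t _) (sym (u-⊕ x y)) (PosSqrt-+ x>0 y>0))

  conj-⊕ : ∀ x y → conj (x ⊕ y) ≡ conj x ⊕ conj y
  conj-⊕ (a , b) (a′ , b′) = cong₂ _,_ first (ℤP.neg-distrib-+ b b′)
    where
    first : (a + a′) + d * (b + b′) ≡ (a + d * b) + (a′ + d * b′)
    first = solve (a ∷ b ∷ a′ ∷ b′ ∷ d ∷ [])

  IsTotPos-⊕ : ∀ {x y} → IsTotPos x → IsTotPos y → IsTotPos (x ⊕ y)
  IsTotPos-⊕ {x} {y} (x>0 , x′>0) (y>0 , y′>0) = IsPos-⊕ x>0 y>0 , subst IsPos (sym (conj-⊕ x y)) (IsPos-⊕ x′>0 y′>0)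

  0<1+d : + 0 < + 1 + d
  0<1+d = ℤP.+-mono-<-≤ {+ 0} {+ 1} (+<+ (s≤s z≤n)) 0≤d

  u-ι : ∀ n → u[ ι n ] ≡ (+ 1 + d) * n
  u-ι n = begin
    n + d * n + d * + 0   ≡⟨ solve (n ∷ d ∷ []) ⟩
    (+ 1 + d) * n         ∎

  IsPos-ι : ∀ {n} → + 0 < n → IsPos (ι n)
  IsPos-ι {n} 0<n = pos (PosSqrt-int (subst (+ 0 <_) (sym (u-ι n)) (0<*0< (0<1+d) 0<n)))

  IsPos-ι⁻¹ : ∀ {n} → IsPos (ι n) → + 0 < n
  IsPos-ι⁻¹ {n} (pos n>0) = ℤP.*-cancelˡ-<-nonNeg (+ 1 + d) {{ℤ.nonNegative (ℤP.<⇒≤ 0<1+d)}}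
    (subst₂ _<_ (sym (ℤP.*-zeroʳ (+ 1 + d))) (u-ι n) (PosSqrt-int⁻¹ n>0))

  conj-ι : ∀ n → conj (ι n) ≡ ι n
  conj-ι n = cong (_, + 0) (trans (cong (λ t → n + t) (ℤP.*-zeroʳ d)) (ℤP.+-identityʳ n))

  IsTotPos-ι : ∀ {n} → + 0 < n → IsTotPos (ι n)
  IsTotPos-ι {n} 0<n = IsPos-ι 0<n , subst IsPos (sym (conj-ι n)) (IsPos-ι 0<n)

  IsPos-⊕ι : ∀ {x n} → + 0 ≤ n → IsPos x → IsPos (x ⊕ ι n)
  IsPos-⊕ι {x} {+ zero} _ x>0 = subst IsPos (sym (⊕-identityʳ x)) x>0
  IsPos-⊕ι {x} {+[1+ _ ]} _ x>0 = IsPos-⊕ x>0 (IsPos-ι (+<+ (s≤s z≤n)))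

  IsPos-⊕ρ : ∀ {x k} → + 0 ≤ k → IsPos x → IsPos (x ⊕ k · ρ)
  IsPos-⊕ρ {x@(a , b)} {k} 0≤k (pos x>0) = pos (subst (λ t → PosSqrt D t (b + k * + 2))
    (sym (trans (u-⊕ x (k · ρ)) (trans (cong (λ t → u[ x ] + t) (u-ρ k)) (ℤP.+-identityʳ u[ x ]))))
    (PosSqrt-monoʳ (0≤*0≤ 0≤k (+≤+ {n = 2} z≤n)) x>0))

  conj-⊕ρ : ∀ a b → conj (a , b) ⊕ b · ρ ≡ (a , b)
  conj-⊕ρ a b = cong₂ _,_ first second
    where
    first : a + d * b + b * - d ≡ a
    first = solve (a ∷ b ∷ d ∷ [])
    second : - b + b * + 2 ≡ b
    second = solve (b ∷ [])

  IsPos-conj⇒IsPos : ∀ {a b} → + 0 ≤ b → IsPos (conj (a , b)) → IsPos (a , b)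
  IsPos-conj⇒IsPos {a} {b} 0≤b x′>0 = subst IsPos (conj-⊕ρ a b) (IsPos-⊕ρ 0≤b x′>0)

  IsPos-dichotomy : ∀ x y → proj₂ (x ⊖ y) ≢ + 0 → ¬ IsPos (x ⊖ y) → IsPos (y ⊖ x)
  IsPos-dichotomy (a , b) (a′ , b′) b-b′≢0 x≯y with PosSqrt-dichotomy b-b′≢0
  ... | inj₁ x>y = ⊥-elim (x≯y (pos x>y))
  ... | inj₂ y>x = pos (subst₂ (PosSqrt D) first second y>x)
    where
    first : - ((a - a′) + d * (a - a′) + d * (b - b′)) ≡ (a′ - a) + d * (a′ - a) + d * (b′ - b)
    first = solve (a ∷ b ∷ a′ ∷ b′ ∷ d ∷ [])
    second : - (b - b′) ≡ b′ - b
    second = solve (b ∷ b′ ∷ [])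

  IsPos-negative-ω : ∀ {a b} → IsPos (a , b) → b < + 0 → + 0 < u[ a , b ] × b * b * + D < u[ a , b ] * u[ a , b ]
  IsPos-negative-ω (pos x>0) = PosSqrt-negative-v x>0

  IsTotPos⇒PosSqrt : ∀ {x} → IsTotPos x → PosSqrt D u[ x ] (proj₂ x) × PosSqrt D u[ x ] (- proj₂ x)
  IsTotPos⇒PosSqrt {x} (pos x>0 , pos x′>0) = x>0 , subst (λ t → PosSqrt D t _) (u-conj x) x′>0

  PosSqrt⇒IsTotPos : ∀ {x} → PosSqrt D u[ x ] (proj₂ x) × PosSqrt D u[ x ] (- proj₂ x) → IsTotPos x
  PosSqrt⇒IsTotPos {x} (x>0 , x′>0) = pos x>0 , pos (subst (λ t → PosSqrt D t _) (sym (u-conj x)) x′>0)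

  IsCeiling : ℤ → OK → Set
  IsCeiling c x = IsPos (x ⊖ ι (c - + 1)) × ¬ IsPos (x ⊖ ι c)

-- Lists of summands

-- ℓ₀ m, ℓ₁ m and ℓ₂ m stand for the totally positive summands 1 + m, ⌈ξ⌉ + m + ω and ⌈2ξ⌉ + m + 2ω of α.
data Summand : Set where
  ℓ₀ ℓ₁ ℓ₂ : ℕ → Summand

height : Summand → ℕ
height (ℓ₀ _) = 0
height (ℓ₁ _) = 1
height (ℓ₂ _) = 2

heights : List Summand → ℕ
heights [] = 0
heights (s ∷ ss) = height s ℕ.+ heights ss

ℓ₀-sum : List ℕ → ℕ
ℓ₀-sum Z = sum (map suc Z)

data Canonical : ℕ → List Summand → Set where
  integers : ∀ Z → Canonical 0 (map ℓ₀ Z)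
  one-ℓ₁   : ∀ m Z → Canonical 1 (ℓ₁ m ∷ map ℓ₀ Z)
  one-ℓ₂   : ∀ m Z → Canonical 2 (ℓ₂ m ∷ map ℓ₀ Z)
  two-ℓ₁   : ∀ m₁ m₂ Z → Canonical 2 (ℓ₁ m₁ ∷ ℓ₁ m₂ ∷ map ℓ₀ Z)

canonical-∷ : ∀ s {h ts} → Canonical h ts → height s ℕ.+ h ℕ.≤ 2 →
              ∃ λ ts′ → s ∷ ts ↭ ts′ × Canonical (height s ℕ.+ h) ts′
canonical-∷ (ℓ₀ m) (integers Z) _ = _ , ↭-refl , integers (m ∷ Z)
canonical-∷ (ℓ₀ m) (one-ℓ₁ m′ Z) _ = _ , ↭-swap _ _ ↭-refl , one-ℓ₁ m′ (m ∷ Z)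
canonical-∷ (ℓ₀ m) (one-ℓ₂ m′ Z) _ = _ , ↭-swap _ _ ↭-refl , one-ℓ₂ m′ (m ∷ Z)
canonical-∷ (ℓ₀ m) (two-ℓ₁ m₁ m₂ Z) _ = _ , ↭-trans (↭-swap _ _ ↭-refl) (↭-prep _ (↭-swap _ _ ↭-refl)) , two-ℓ₁ m₁ m₂ (m ∷ Z)
canonical-∷ (ℓ₁ m) (integers Z) _ = _ , ↭-refl , one-ℓ₁ m Z
canonical-∷ (ℓ₁ m) (one-ℓ₁ m′ Z) _ = _ , ↭-refl , two-ℓ₁ m m′ Z
canonical-∷ (ℓ₂ m) (integers Z) _ = _ , ↭-refl , one-ℓ₂ m Z
canonical-∷ (ℓ₁ _) (one-ℓ₂ _ _) (s≤s (s≤s ()))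
canonical-∷ (ℓ₁ _) (two-ℓ₁ _ _ _) (s≤s (s≤s ()))
canonical-∷ (ℓ₂ _) (one-ℓ₁ _ _) (s≤s (s≤s ()))
canonical-∷ (ℓ₂ _) (one-ℓ₂ _ _) (s≤s (s≤s ()))
canonical-∷ (ℓ₂ _) (two-ℓ₁ _ _ _) (s≤s (s≤s ()))

canonicalise : ∀ ss → heights ss ℕ.≤ 2 → ∃ λ ts → ss ↭ ts × Canonical (heights ss) ts
canonicalise [] _ = [] , ↭-refl , integers []
canonicalise (s ∷ ss) h≤2 with canonicalise ss (ℕP.≤-trans (ℕP.m≤n+m (heights ss) (height s)) h≤2)
... | ts , ss↭ts , ts-canonical with canonical-∷ s ts-canonical h≤2
...   | ts′ , s∷ts↭ts′ , ts′-canonical = ts′ , ↭-trans (↭-prep s ss↭ts) s∷ts↭ts′ , ts′-canonical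

codes-ℓ₂ : Fin 4 → List Summand
codes-ℓ₂ Fin.zero = ℓ₂ 2 ∷ []
codes-ℓ₂ (Fin.suc Fin.zero) = ℓ₂ 1 ∷ ℓ₀ 0 ∷ []
codes-ℓ₂ (Fin.suc (Fin.suc Fin.zero)) = ℓ₂ 0 ∷ ℓ₀ 1 ∷ []
codes-ℓ₂ (Fin.suc (Fin.suc (Fin.suc Fin.zero))) = ℓ₂ 0 ∷ ℓ₀ 0 ∷ ℓ₀ 0 ∷ []

enumerate-ℓ₂ : ∀ m Z → m ℕ.+ ℓ₀-sum Z ≡ 2 → ∃ λ j → ℓ₂ m ∷ map ℓ₀ Z ↭ codes-ℓ₂ j
enumerate-ℓ₂ 2 [] refl = Fin.zero , ↭-refl
enumerate-ℓ₂ 1 (0 ∷ []) refl = Fin.suc Fin.zero , ↭-refl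
enumerate-ℓ₂ 0 (1 ∷ []) refl = Fin.suc (Fin.suc Fin.zero) , ↭-refl
enumerate-ℓ₂ 0 (0 ∷ 0 ∷ []) refl = Fin.suc (Fin.suc (Fin.suc Fin.zero)) , ↭-refl

codes-ℓ₁¹ : Fin 2 → List Summand
codes-ℓ₁¹ Fin.zero = ℓ₁ 0 ∷ ℓ₁ 0 ∷ ℓ₀ 0 ∷ []
codes-ℓ₁¹ (Fin.suc Fin.zero) = ℓ₁ 0 ∷ ℓ₁ 1 ∷ []

enumerate-ℓ₁¹ : ∀ m₁ m₂ Z → m₁ ℕ.+ m₂ ℕ.+ ℓ₀-sum Z ≡ 1 → ∃ λ j → ℓ₁ m₁ ∷ ℓ₁ m₂ ∷ map ℓ₀ Z ↭ codes-ℓ₁¹ j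
enumerate-ℓ₁¹ 0 0 (0 ∷ []) refl = Fin.zero , ↭-refl
enumerate-ℓ₁¹ 0 1 [] refl = Fin.suc Fin.zero , ↭-refl
enumerate-ℓ₁¹ 1 0 [] refl = Fin.suc Fin.zero , ↭-swap _ _ ↭-refl

codes-ℓ₁² : Fin 5 → List Summand
codes-ℓ₁² Fin.zero = ℓ₁ 0 ∷ ℓ₁ 0 ∷ ℓ₀ 1 ∷ []
codes-ℓ₁² (Fin.suc Fin.zero) = ℓ₁ 0 ∷ ℓ₁ 0 ∷ ℓ₀ 0 ∷ ℓ₀ 0 ∷ []
codes-ℓ₁² (Fin.suc (Fin.suc Fin.zero)) = ℓ₁ 0 ∷ ℓ₁ 1 ∷ ℓ₀ 0 ∷ []
codes-ℓ₁² (Fin.suc (Fin.suc (Fin.suc Fin.zero))) = ℓ₁ 1 ∷ ℓ₁ 1 ∷ []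
codes-ℓ₁² (Fin.suc (Fin.suc (Fin.suc (Fin.suc Fin.zero)))) = ℓ₁ 0 ∷ ℓ₁ 2 ∷ []

enumerate-ℓ₁² : ∀ m₁ m₂ Z → m₁ ℕ.+ m₂ ℕ.+ ℓ₀-sum Z ≡ 2 → ∃ λ j → ℓ₁ m₁ ∷ ℓ₁ m₂ ∷ map ℓ₀ Z ↭ codes-ℓ₁² j
enumerate-ℓ₁² 0 0 (1 ∷ []) refl = Fin.zero , ↭-refl
enumerate-ℓ₁² 0 0 (0 ∷ 0 ∷ []) refl = Fin.suc Fin.zero , ↭-refl
enumerate-ℓ₁² 0 1 (0 ∷ []) refl = Fin.suc (Fin.suc Fin.zero) , ↭-refl
enumerate-ℓ₁² 1 0 (0 ∷ []) refl = Fin.suc (Fin.suc Fin.zero) , ↭-swap _ _ ↭-refl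
enumerate-ℓ₁² 1 1 [] refl = Fin.suc (Fin.suc (Fin.suc Fin.zero)) , ↭-refl
enumerate-ℓ₁² 0 2 [] refl = Fin.suc (Fin.suc (Fin.suc (Fin.suc Fin.zero))) , ↭-refl
enumerate-ℓ₁² 2 0 [] refl = Fin.suc (Fin.suc (Fin.suc (Fin.suc Fin.zero))) , ↭-swap _ _ ↭-refl

-- Base-3 digits: a multiset of summands, each occurring at most twice, is determined by its fingerprint.
fingerprint : List Summand → ℕ
fingerprint ss = sum (map (λ s → 3 ^ digit s) ss)
  where
  digit : Summand → ℕ
  digit (ℓ₀ m) = 3 ℕ.* m
  digit (ℓ₁ m) = 3 ℕ.* m ℕ.+ 1
  digit (ℓ₂ m) = 3 ℕ.* m ℕ.+ 2

fingerprint-↭ : ∀ {ss ts} → ss ↭ ts → fingerprint ss ≡ fingerprint ts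
fingerprint-↭ ss↭ts = sum-↭ (PermP.map⁺ _ ss↭ts)

fingerprints-distinct? : ∀ {n} (codes : Fin n → List Summand) →
                         Dec (∀ i j → fingerprint (codes i) ≡ fingerprint (codes j) → i ≡ j)
fingerprints-distinct? codes = FinP.all? λ i → FinP.all? λ j → (fingerprint (codes i) ℕ.≟ fingerprint (codes j)) →-dec (i FinP.≟ j)

codes : ∀ {r} → (Fin r → List Summand) → Fin (4 ℕ.+ r) → List Summand
codes codes-ℓ₁ = [ codes-ℓ₂ , codes-ℓ₁ ]′ ∘ splitAt 4

codes-ℓ₁¹-distinct : ∀ i j → codes codes-ℓ₁¹ i ↭ codes codes-ℓ₁¹ j → i ≡ j
codes-ℓ₁¹-distinct i j p = from-yes (fingerprints-distinct? (codes codes-ℓ₁¹)) i j (fingerprint-↭ p)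

codes-ℓ₁²-distinct : ∀ i j → codes codes-ℓ₁² i ↭ codes codes-ℓ₁² j → i ≡ j
codes-ℓ₁²-distinct i j p = from-yes (fingerprints-distinct? (codes codes-ℓ₁²)) i j (fingerprint-↭ p)

module Interpretation (c c₂ : ℤ) where

  ⟦_⟧ : Summand → OK
  ⟦ ℓ₀ m ⟧ = ι +[1+ m ]
  ⟦ ℓ₁ m ⟧ = (c + + m , + 1)
  ⟦ ℓ₂ m ⟧ = (c₂ + + m , + 2)

  α : OK
  α = (c₂ + + 2 , + 2)

  ⟦⟧-injective : ∀ {s t} → ⟦ s ⟧ ≡ ⟦ t ⟧ → s ≡ t
  ⟦⟧-injective {ℓ₀ m} {ℓ₀ .m} refl = refl
  ⟦⟧-injective {ℓ₁ m} {ℓ₁ n} eq = cong ℓ₁ (ℤP.+-injective (+-cancelˡ-≡ c (cong proj₁ eq)))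
  ⟦⟧-injective {ℓ₂ m} {ℓ₂ n} eq = cong ℓ₂ (ℤP.+-injective (+-cancelˡ-≡ c₂ (cong proj₁ eq)))
  ⟦⟧-injective {ℓ₀ _} {ℓ₁ _} eq with () ← cong proj₂ eq
  ⟦⟧-injective {ℓ₀ _} {ℓ₂ _} eq with () ← cong proj₂ eq
  ⟦⟧-injective {ℓ₁ _} {ℓ₀ _} eq with () ← cong proj₂ eq
  ⟦⟧-injective {ℓ₁ _} {ℓ₂ _} eq with () ← cong proj₂ eq
  ⟦⟧-injective {ℓ₂ _} {ℓ₀ _} eq with () ← cong proj₂ eq
  ⟦⟧-injective {ℓ₂ _} {ℓ₁ _} eq with () ← cong proj₂ eq

  ω-coefficient-sum : ∀ ss → proj₂ (sumOK (map ⟦_⟧ ss)) ≡ + heights ss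
  ω-coefficient-sum [] = refl
  ω-coefficient-sum (ℓ₀ _ ∷ ss) = cong (λ t → + 0 + t) (ω-coefficient-sum ss)
  ω-coefficient-sum (ℓ₁ _ ∷ ss) = cong (λ t → + 1 + t) (ω-coefficient-sum ss)
  ω-coefficient-sum (ℓ₂ _ ∷ ss) = cong (λ t → + 2 + t) (ω-coefficient-sum ss)

  ℓ₀s-sum : ∀ Z → sumOK (map ⟦_⟧ (map ℓ₀ Z)) ≡ ι (+ ℓ₀-sum Z)
  ℓ₀s-sum [] = refl
  ℓ₀s-sum (m ∷ Z) = cong (⟦ ℓ₀ m ⟧ ⊕_) (ℓ₀s-sum Z)

  one-ℓ₂-sum : ∀ m Z → sumOK (map ⟦_⟧ (ℓ₂ m ∷ map ℓ₀ Z)) ≡ (c₂ + + (m ℕ.+ ℓ₀-sum Z) , + 2)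
  one-ℓ₂-sum m Z = trans (cong (⟦ ℓ₂ m ⟧ ⊕_) (ℓ₀s-sum Z)) (cong (_, + 2) (ℤP.+-assoc c₂ (+ m) (+ ℓ₀-sum Z)))

  two-ℓ₁-sum : ∀ m₁ m₂ Z → sumOK (map ⟦_⟧ (ℓ₁ m₁ ∷ ℓ₁ m₂ ∷ map ℓ₀ Z)) ≡ (c + c + + (m₁ ℕ.+ m₂ ℕ.+ ℓ₀-sum Z) , + 2)
  two-ℓ₁-sum m₁ m₂ Z =
    trans (cong (λ t → ⟦ ℓ₁ m₁ ⟧ ⊕ (⟦ ℓ₁ m₂ ⟧ ⊕ t)) (ℓ₀s-sum Z)) (cong (_, + 2) (rearrange (+ m₁) (+ m₂) (+ ℓ₀-sum Z)))
    where
    rearrange : ∀ x y z → (c + x) + ((c + y) + z) ≡ c + c + (x + y + z)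
    rearrange x y z = solve (c ∷ x ∷ y ∷ z ∷ [])

  heights≡2 : ∀ ss → sumOK (map ⟦_⟧ ss) ≡ α → heights ss ≡ 2
  heights≡2 ss Σ≡α = ℤP.+-injective (trans (sym (ω-coefficient-sum ss)) (cong proj₂ Σ≡α))

  one-ℓ₂-sum≡α⁻ : ∀ m Z → sumOK (map ⟦_⟧ (ℓ₂ m ∷ map ℓ₀ Z)) ≡ α → m ℕ.+ ℓ₀-sum Z ≡ 2
  one-ℓ₂-sum≡α⁻ m Z Σ≡α = ℤP.+-injective (+-cancelˡ-≡ c₂ (cong proj₁ (trans (sym (one-ℓ₂-sum m Z)) Σ≡α)))

  one-ℓ₂-sum≡α : ∀ m Z → m ℕ.+ ℓ₀-sum Z ≡ 2 → sumOK (map ⟦_⟧ (ℓ₂ m ∷ map ℓ₀ Z)) ≡ α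
  one-ℓ₂-sum≡α m Z weight≡2 = trans (one-ℓ₂-sum m Z) (cong (λ n → (c₂ + + n , + 2)) weight≡2)

  codes-ℓ₂-sum : ∀ j → sumOK (map ⟦_⟧ (codes-ℓ₂ j)) ≡ α
  codes-ℓ₂-sum Fin.zero = one-ℓ₂-sum≡α 2 [] refl
  codes-ℓ₂-sum (Fin.suc Fin.zero) = one-ℓ₂-sum≡α 1 (0 ∷ []) refl
  codes-ℓ₂-sum (Fin.suc (Fin.suc Fin.zero)) = one-ℓ₂-sum≡α 0 (1 ∷ []) refl
  codes-ℓ₂-sum (Fin.suc (Fin.suc (Fin.suc Fin.zero))) = one-ℓ₂-sum≡α 0 (0 ∷ 0 ∷ []) refl

  module _ {k : ℕ} (c₂+2≡c+c+k : c₂ + + 2 ≡ c + c + + k) where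

    two-ℓ₁-sum≡α⁻ : ∀ m₁ m₂ Z → sumOK (map ⟦_⟧ (ℓ₁ m₁ ∷ ℓ₁ m₂ ∷ map ℓ₀ Z)) ≡ α → m₁ ℕ.+ m₂ ℕ.+ ℓ₀-sum Z ≡ k
    two-ℓ₁-sum≡α⁻ m₁ m₂ Z Σ≡α =
      ℤP.+-injective (+-cancelˡ-≡ (c + c) (trans (cong proj₁ (trans (sym (two-ℓ₁-sum m₁ m₂ Z)) Σ≡α)) c₂+2≡c+c+k))

    two-ℓ₁-sum≡α : ∀ m₁ m₂ Z → m₁ ℕ.+ m₂ ℕ.+ ℓ₀-sum Z ≡ k → sumOK (map ⟦_⟧ (ℓ₁ m₁ ∷ ℓ₁ m₂ ∷ map ℓ₀ Z)) ≡ α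
    two-ℓ₁-sum≡α m₁ m₂ Z weight≡k =
      trans (two-ℓ₁-sum m₁ m₂ Z) (cong (_, + 2) (trans (cong (λ n → c + c + + n) weight≡k) (sym c₂+2≡c+c+k)))

  codes-ℓ₁¹-sum : c₂ + + 2 ≡ c + c + + 1 → ∀ j → sumOK (map ⟦_⟧ (codes-ℓ₁¹ j)) ≡ α
  codes-ℓ₁¹-sum h Fin.zero = two-ℓ₁-sum≡α h 0 0 (0 ∷ []) refl
  codes-ℓ₁¹-sum h (Fin.suc Fin.zero) = two-ℓ₁-sum≡α h 0 1 [] refl

  codes-ℓ₁²-sum : c₂ + + 2 ≡ c + c + + 2 → ∀ j → sumOK (map ⟦_⟧ (codes-ℓ₁² j)) ≡ α
  codes-ℓ₁²-sum h Fin.zero = two-ℓ₁-sum≡α h 0 0 (1 ∷ []) refl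
  codes-ℓ₁²-sum h (Fin.suc Fin.zero) = two-ℓ₁-sum≡α h 0 0 (0 ∷ 0 ∷ []) refl
  codes-ℓ₁²-sum h (Fin.suc (Fin.suc Fin.zero)) = two-ℓ₁-sum≡α h 0 1 (0 ∷ []) refl
  codes-ℓ₁²-sum h (Fin.suc (Fin.suc (Fin.suc Fin.zero))) = two-ℓ₁-sum≡α h 1 1 [] refl
  codes-ℓ₁²-sum h (Fin.suc (Fin.suc (Fin.suc (Fin.suc Fin.zero)))) = two-ℓ₁-sum≡α h 0 2 [] refl

  module Codes {k : ℕ} (c₂+2≡c+c+k : c₂ + + 2 ≡ c + c + + k) {r} (codes-ℓ₁ : Fin r → List Summand)
               (codes-ℓ₁-sum : ∀ j → sumOK (map ⟦_⟧ (codes-ℓ₁ j)) ≡ α)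
               (enumerate-ℓ₁ : ∀ m₁ m₂ Z → m₁ ℕ.+ m₂ ℕ.+ ℓ₀-sum Z ≡ k →
                               ∃ λ j → ℓ₁ m₁ ∷ ℓ₁ m₂ ∷ map ℓ₀ Z ↭ codes-ℓ₁ j) where

    codes-sum : ∀ i → sumOK (map ⟦_⟧ (codes codes-ℓ₁ i)) ≡ α
    codes-sum i with splitAt 4 i
    ... | inj₁ j = codes-ℓ₂-sum j
    ... | inj₂ j = codes-ℓ₁-sum j

    canonical-complete : ∀ {ts} → Canonical 2 ts → sumOK (map ⟦_⟧ ts) ≡ α → ∃ λ i → ts ↭ codes codes-ℓ₁ i
    canonical-complete (one-ℓ₂ m Z) Σ≡α with enumerate-ℓ₂ m Z (one-ℓ₂-sum≡α⁻ m Z Σ≡α)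
    ... | j , p = j ↑ˡ r , subst (_ ↭_) (sym (cong [ codes-ℓ₂ , codes-ℓ₁ ]′ (FinP.splitAt-↑ˡ 4 j r))) p
    canonical-complete (two-ℓ₁ m₁ m₂ Z) Σ≡α with enumerate-ℓ₁ m₁ m₂ Z (two-ℓ₁-sum≡α⁻ c₂+2≡c+c+k m₁ m₂ Z Σ≡α)
    ... | j , p = 4 ↑ʳ j , subst (_ ↭_) (sym (cong [ codes-ℓ₂ , codes-ℓ₁ ]′ (FinP.splitAt-↑ʳ 4 r j))) p

    codes-complete : ∀ ss → sumOK (map ⟦_⟧ ss) ≡ α → ∃ λ i → ss ↭ codes codes-ℓ₁ i
    codes-complete ss Σ≡α with canonicalise ss (ℕP.≤-reflexive (heights≡2 ss Σ≡α))
    ... | ts , ss↭ts , ts-canonical =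
      map₂ (↭-trans ss↭ts) (canonical-complete (subst (λ h → Canonical h ts) (heights≡2 ss Σ≡α) ts-canonical)
                                             (trans (sym (sumOK-↭ (PermP.map⁺ ⟦_⟧ ss↭ts))) Σ≡α))

module Partitions (D : ℕ) (irrational : IrrationalSqrt D) (d : ℤ) (0≤d : + 0 ℤ.≤ d) (d²≡d : d * d ≡ d)
                  (D-large : (+ 5 + + 5 * d) * (+ 5 + + 5 * d) < + 16 * + D) (c c₂ : ℤ) where

  open Data.Integer using (_≤_)
  open Embedding D irrational d 0≤d d²≡d
  open Interpretation c c₂

  ξᵈ : OK
  ξᵈ = ω ⊖ ι d

  module SummandsOfα (c-ceiling : IsCeiling c ξᵈ) (c₂-ceiling : IsCeiling c₂ (+ 2 · ξᵈ)) where

    ξ>c-1 : IsPos (ξᵈ ⊖ ι (c - + 1))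
    ξ>c-1 = proj₁ c-ceiling

    c>ξ : IsPos (ι c ⊖ ξᵈ)
    c>ξ = IsPos-dichotomy ξᵈ (ι c) (λ ()) (proj₂ c-ceiling)

    2ξ>c₂-1 : IsPos (+ 2 · ξᵈ ⊖ ι (c₂ - + 1))
    2ξ>c₂-1 = proj₁ c₂-ceiling

    c₂>2ξ : IsPos (ι c₂ ⊖ + 2 · ξᵈ)
    c₂>2ξ = IsPos-dichotomy (+ 2 · ξᵈ) (ι c₂) (λ ()) (proj₂ c₂-ceiling)

    positive-integer : ∀ {x y n} → IsPos x → IsPos y → x ⊕ y ≡ ι n → + 0 < n
    positive-integer x>0 y>0 x+y≡n = IsPos-ι⁻¹ (subst IsPos x+y≡n (IsPos-⊕ x>0 y>0))

    IsTotPos-⟦⟧ : ∀ s → IsTotPos ⟦ s ⟧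
    IsTotPos-⟦⟧ (ℓ₀ m) = IsTotPos-ι (+<+ (s≤s z≤n))
    IsTotPos-⟦⟧ (ℓ₁ m) = IsPos-conj⇒IsPos (+≤+ z≤n) conj>0 , conj>0
      where
      shift : ∀ k → (c - (+ 0 - d)) + k ≡ (c + k) + d * + 1
      shift k = solve (c ∷ d ∷ k ∷ [])
      conj>0 : IsPos (conj ⟦ ℓ₁ m ⟧)
      conj>0 = subst IsPos (cong₂ _,_ (shift (+ m)) refl) (IsPos-⊕ι (+≤+ z≤n) c>ξ)
    IsTotPos-⟦⟧ (ℓ₂ m) = IsPos-conj⇒IsPos (+≤+ z≤n) conj>0 , conj>0
      where
      shift : ∀ k → (c₂ - + 2 * (+ 0 - d)) + k ≡ (c₂ + k) + d * + 2
      shift k = solve (c₂ ∷ d ∷ k ∷ [])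
      conj>0 : IsPos (conj ⟦ ℓ₂ m ⟧)
      conj>0 = subst IsPos (cong₂ _,_ (shift (+ m)) refl) (IsPos-⊕ι (+≤+ z≤n) c₂>2ξ)

    summand-ω⁰ : ∀ {a} → IsPos (a , + 0) → ∃ λ s → (a , + 0) ≡ ⟦ s ⟧
    summand-ω⁰ {+[1+ m ]} _ = ℓ₀ m , refl
    summand-ω⁰ {+ zero} a>0 with +<+ () ← IsPos-ι⁻¹ a>0
    summand-ω⁰ { -[1+ _ ]} a>0 with () ← IsPos-ι⁻¹ a>0

    summand-ω¹ : ∀ {a} → IsPos (conj (a , + 1)) → ∃ λ s → (a , + 1) ≡ ⟦ s ⟧
    summand-ω¹ {a} a′>0 = ℓ₁ _ , cong (_, + 1) (0≤i-j⇒i≡j+∣i-j∣ (0<1+i⇒0≤i (a - c) (positive-integer a′>0 ξ>c-1 (cong₂ _,_ first refl))))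
      where
      first : (a + d * + 1) + ((+ 0 - d) - (c - + 1)) ≡ + 1 + (a - c)
      first = solve (a ∷ c ∷ d ∷ [])

    summand-ω² : ∀ {a} → IsPos (conj (a , + 2)) → ∃ λ s → (a , + 2) ≡ ⟦ s ⟧
    summand-ω² {a} a′>0 = ℓ₂ _ , cong (_, + 2) (0≤i-j⇒i≡j+∣i-j∣ (0<1+i⇒0≤i (a - c₂) (positive-integer a′>0 2ξ>c₂-1 (cong₂ _,_ first refl))))
      where
      first : (a + d * + 2) + (+ 2 * (+ 0 - d) - (c₂ - + 1)) ≡ + 1 + (a - c₂)
      first = solve (a ∷ c₂ ∷ d ∷ [])

    -- β = c₂ + 2 + 3δ − 4ω.  Positivity of β would give 4√D < 5(1 + δ), which D-large forbids.
    β : OK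
    β = (c₂ + + 2 + + 3 * d , - + 4)

    ¬IsPos-β : ¬ IsPos β
    ¬IsPos-β β>0 = ℤP.<-irrefl refl (ℤP.<-trans (ℤP.<-≤-trans 16D<u² (*-self-mono-≤ (ℤP.<⇒≤ 0<u) u≤5+5d)) D-large)
      where
      t : ℤ
      t = + 3 - c₂ - d
      0≤t : + 0 ≤ t
      0≤t = 0<1+i⇒0≤i t (positive-integer β>0 (IsPos-⊕ 2ξ>c₂-1 2ξ>c₂-1) (cong₂ _,_ first refl))
        where
        first : (c₂ + + 2 + + 3 * d) + ((+ 2 * (+ 0 - d) - (c₂ - + 1)) + (+ 2 * (+ 0 - d) - (c₂ - + 1))) ≡ + 1 + (+ 3 - c₂ - d)
        first = solve (c₂ ∷ d ∷ [])
      u : ℤ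
      u = (c₂ + + 2 + + 3 * d) + d * (c₂ + + 2 + + 3 * d) + d * - + 4
      0<u : + 0 < u
      0<u = proj₁ (IsPos-negative-ω β>0 (ℤ.-<+))
      16D<u² : + 16 * + D < u * u
      16D<u² = proj₂ (IsPos-negative-ω β>0 (ℤ.-<+))
      u≤5+5d : u ≤ + 5 + + 5 * d
      u≤5+5d = ≤-by ((+ 1 + d) * t) (0≤*0≤ (ℤP.<⇒≤ 0<1+d) 0≤t) (begin
        + 5 + + 5 * d                                  ≡⟨ expand ⟩
        u + (+ 1 + d) * t + + 2 * (d - d * d)          ≡⟨ cong (λ e → u + (+ 1 + d) * t + + 2 * (d - e)) d²≡d ⟩
        u + (+ 1 + d) * t + + 2 * (d - d)              ≡⟨ collapse (u + (+ 1 + d) * t) ⟩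
        u + (+ 1 + d) * t                              ∎)
        where
        expand : + 5 + + 5 * d ≡ (c₂ + + 2 + + 3 * d) + d * (c₂ + + 2 + + 3 * d) + d * - + 4
                                 + (+ 1 + d) * (+ 3 - c₂ - d) + + 2 * (d - d * d)
        expand = solve (c₂ ∷ d ∷ [])
        collapse : ∀ x → x + + 2 * (d - d) ≡ x
        collapse x = solve (x ∷ d ∷ [])

    ω-coefficient-nonneg : ∀ {a₁ b₁ a₂ b₂} → IsTotPos (a₁ , b₁) → IsTotPos (a₂ , b₂) → (a₁ , b₁) ⊕ (a₂ , b₂) ≡ α → + 0 ≤ b₁
    ω-coefficient-nonneg {a₁} {b₁} {a₂} {b₂} (x₁>0 , _) (_ , x₂′>0) x₁+x₂≡α with <0⊎0≤ b₁
    ... | inj₂ 0≤b₁ = 0≤b₁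
    ... | inj₁ b₁<0 = ⊥-elim (¬IsPos-β (subst IsPos (cong₂ _,_ first second)
                        (IsPos-⊕ρ (ℤP.neg-mono-≤ (ℤP.i<j⇒suc[i]≤j b₁<0)) (IsPos-⊕ x₁>0 x₂′>0))))
      where
      first : (a₁ + (a₂ + d * b₂)) + - (+ 1 + b₁) * - d ≡ c₂ + + 2 + + 3 * d
      first = begin
        (a₁ + (a₂ + d * b₂)) + - (+ 1 + b₁) * - d   ≡⟨ solve (a₁ ∷ a₂ ∷ b₁ ∷ b₂ ∷ d ∷ []) ⟩
        (a₁ + a₂) + d * (b₁ + b₂) + d               ≡⟨ cong₂ (λ s t → s + d * t + d) (cong proj₁ x₁+x₂≡α) (cong proj₂ x₁+x₂≡α) ⟩
        (c₂ + + 2) + d * + 2 + d                    ≡⟨ solve (c₂ ∷ d ∷ []) ⟩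
        c₂ + + 2 + + 3 * d                          ∎
      second : (b₁ + - b₂) + - (+ 1 + b₁) * + 2 ≡ - + 4
      second = begin
        (b₁ + - b₂) + - (+ 1 + b₁) * + 2            ≡⟨ solve (b₁ ∷ b₂ ∷ []) ⟩
        - (b₁ + b₂) - + 2                           ≡⟨ cong (λ t → - t - + 2) (cong proj₂ x₁+x₂≡α) ⟩
        - + 4                                       ∎

    IsTotPos₀ : OK → Set
    IsTotPos₀ y = y ≡ (+ 0 , + 0) ⊎ IsTotPos y

    summand-of-α : ∀ {x y} → IsTotPos x → IsTotPos₀ y → x ⊕ y ≡ α → ∃ λ s → x ≡ ⟦ s ⟧
    summand-of-α {x} _ (inj₁ refl) x≡α = ℓ₂ 2 , trans (sym (⊕-identityʳ x)) x≡α
    summand-of-α {a , b} {a′ , b′} x≫0 (inj₂ y≫0) x+y≡α =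
      by-ω-coefficient (ω-coefficient-nonneg x≫0 y≫0 x+y≡α) (ω-coefficient-nonneg y≫0 x≫0 (trans (⊕-comm (a′ , b′) (a , b)) x+y≡α))
                       (cong proj₂ x+y≡α) x≫0
      where
      by-ω-coefficient : ∀ {b b′} → + 0 ≤ b → + 0 ≤ b′ → b + b′ ≡ + 2 → IsTotPos (a , b) → ∃ λ s → (a , b) ≡ ⟦ s ⟧
      by-ω-coefficient {+ 0} _ _ _ (x>0 , _) = summand-ω⁰ x>0
      by-ω-coefficient {+ 1} _ _ _ (_ , x′>0) = summand-ω¹ x′>0
      by-ω-coefficient {+ 2} _ _ _ (_ , x′>0) = summand-ω² x′>0
      by-ω-coefficient {+ suc (suc (suc _))} {+ _} _ _ ()

    IsTotPos₀-⊕ : ∀ {x y} → IsTotPos₀ x → IsTotPos₀ y → IsTotPos₀ (x ⊕ y)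
    IsTotPos₀-⊕ {y = y} (inj₁ refl) y≥0 = subst IsTotPos₀ (sym (⊕-identityˡ y)) y≥0
    IsTotPos₀-⊕ {x} (inj₂ x≫0) (inj₁ refl) = inj₂ (subst IsTotPos (sym (⊕-identityʳ x)) x≫0)
    IsTotPos₀-⊕ (inj₂ x≫0) (inj₂ y≫0) = inj₂ (IsTotPos-⊕ x≫0 y≫0)

    IsTotPos₀-sum : ∀ {xs} → All IsTotPos xs → IsTotPos₀ (sumOK xs)
    IsTotPos₀-sum All.[] = inj₁ refl
    IsTotPos₀-sum (x≫0 All.∷ xs≫0) = IsTotPos₀-⊕ (inj₂ x≫0) (IsTotPos₀-sum xs≫0)

    complement : ∀ {x xs} → All IsTotPos xs → x ∈ xs → ∃ λ y → IsTotPos₀ y × x ⊕ y ≡ sumOK xs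
    complement (_ All.∷ xs≫0) (here refl) = _ , IsTotPos₀-sum xs≫0 , refl
    complement {x} {x₀ ∷ xs} (x₀≫0 All.∷ xs≫0) (there x∈xs) with complement xs≫0 x∈xs
    ... | y , y≥0 , x+y≡Σxs = x₀ ⊕ y , IsTotPos₀-⊕ (inj₂ x₀≫0) y≥0 , (begin
      x ⊕ (x₀ ⊕ y)   ≡⟨ ⊕-assoc x x₀ y ⟨
      (x ⊕ x₀) ⊕ y   ≡⟨ cong (_⊕ y) (⊕-comm x x₀) ⟩
      (x₀ ⊕ x) ⊕ y   ≡⟨ ⊕-assoc x₀ x y ⟩
      x₀ ⊕ (x ⊕ y)   ≡⟨ cong (x₀ ⊕_) x+y≡Σxs ⟩
      x₀ ⊕ sumOK xs  ∎)

    summands-of-α : ∀ {xs} → All IsTotPos xs → sumOK xs ≡ α → ∃ λ ss → xs ≡ map ⟦_⟧ ss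
    summands-of-α {xs} xs≫0 Σxs≡α = All-∃⇒map (All.tabulate λ {x} x∈xs → summand x∈xs)
      where
      summand : ∀ {x} → x ∈ xs → ∃ λ s → x ≡ ⟦ s ⟧
      summand x∈xs with complement xs≫0 x∈xs
      ... | y , y≥0 , x+y≡Σxs = summand-of-α (All.lookup xs≫0 x∈xs) y≥0 (trans x+y≡Σxs Σxs≡α)

    ⌈2ξ⌉≡2⌈ξ⌉-1 : IsPos (ι (+ 2 * c - + 1) ⊖ + 2 · ξᵈ) → c₂ + + 2 ≡ c + c + + 1
    ⌈2ξ⌉≡2⌈ξ⌉-1 2ξ<2c-1 = ℤP.i-j≡0⇒i≡j _ _ (0<1±i⇒i≡0 _
      (positive-integer (IsPos-⊕ ξ>c-1 ξ>c-1) c₂>2ξ (cong₂ _,_ first refl))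
      (positive-integer 2ξ<2c-1 2ξ>c₂-1 (cong₂ _,_ second refl)))
      where
      first : (((+ 0 - d) - (c - + 1)) + ((+ 0 - d) - (c - + 1))) + (c₂ - + 2 * (+ 0 - d)) ≡ + 1 + (c₂ + + 2 - (c + c + + 1))
      first = solve (c ∷ c₂ ∷ d ∷ [])
      second : ((+ 2 * c - + 1) - + 2 * (+ 0 - d)) + (+ 2 * (+ 0 - d) - (c₂ - + 1)) ≡ + 1 - (c₂ + + 2 - (c + c + + 1))
      second = solve (c ∷ c₂ ∷ d ∷ [])

    ⌈2ξ⌉≡2⌈ξ⌉ : IsPos (+ 2 · ξᵈ ⊖ ι (+ 2 * c - + 1)) → c₂ + + 2 ≡ c + c + + 2
    ⌈2ξ⌉≡2⌈ξ⌉ 2ξ>2c-1 = ℤP.i-j≡0⇒i≡j _ _ (0<1±i⇒i≡0 _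
      (positive-integer 2ξ>2c-1 c₂>2ξ (cong₂ _,_ first refl))
      (positive-integer 2ξ>c₂-1 (IsPos-⊕ c>ξ c>ξ) (cong₂ _,_ second refl)))
      where
      first : (+ 2 * (+ 0 - d) - (+ 2 * c - + 1)) + (c₂ - + 2 * (+ 0 - d)) ≡ + 1 + (c₂ + + 2 - (c + c + + 2))
      first = solve (c ∷ c₂ ∷ d ∷ [])
      second : (+ 2 * (+ 0 - d) - (c₂ - + 1)) + ((c - (+ 0 - d)) + (c - (+ 0 - d))) ≡ + 1 - (c₂ + + 2 - (c + c + + 2))
      second = solve (c ∷ c₂ ∷ d ∷ [])

-- The size of D

1-mod-4⇒13≤ : ∀ {D} → 2 ℕ.≤ D → SquareFree D → D ≢ 5 → D % 4 ≡ 1 → 13 ℕ.≤ D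
1-mod-4⇒13≤ {D} 2≤D squarefree D≢5 D%4≡1 = by-quotient (D / 4) D≡1+4q
  where
  D≡1+4q : D ≡ 1 ℕ.+ (D / 4) ℕ.* 4
  D≡1+4q = trans (ℕDivMod.m≡m%n+[m/n]*n D 4) (cong (ℕ._+ (D / 4) ℕ.* 4) D%4≡1)
  by-quotient : ∀ q → D ≡ 1 ℕ.+ q ℕ.* 4 → 13 ℕ.≤ D
  by-quotient 0 D≡1 = ⊥-elim (ℕP.<-irrefl refl (subst (2 ℕ.≤_) D≡1 2≤D))
  by-quotient 1 D≡5 = ⊥-elim (D≢5 D≡5)
  by-quotient 2 D≡9 = ⊥-elim (squarefree 3 (from-yes (prime? 3)) (divides 1 D≡9))
  by-quotient (suc (suc (suc q))) D≡13+4q = subst (13 ℕ.≤_) (sym D≡13+4q) (ℕP.m≤m+n 13 (q ℕ.* 4))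

0≤δ' : ∀ n → + 0 ℤ.≤ δ' n
0≤δ' 1 = +≤+ z≤n
0≤δ' 0 = +≤+ z≤n
0≤δ' (suc (suc _)) = +≤+ z≤n

δ'-idempotent : ∀ n → δ' n * δ' n ≡ δ' n
δ'-idempotent 1 = refl
δ'-idempotent 0 = refl
δ'-idempotent (suc (suc _)) = refl

below-16D : ∀ {a D} → a ℕ.< 16 ℕ.* D → + a < + 16 * + D
below-16D {D = D} a<16D = subst (_ <_) (ℤP.pos-* 16 D) (+<+ a<16D)

D-large : ∀ {D} → 2 ℕ.≤ D → SquareFree D → D ≢ 5 →
          (+ 5 + + 5 * δ' (D % 4)) * (+ 5 + + 5 * δ' (D % 4)) < + 16 * + D
D-large {D} 2≤D squarefree D≢5 with D % 4 in D%4≡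
... | 1 = below-16D {D = D} (ℕP.<-≤-trans (from-yes (100 ℕ.<? 208)) (ℕP.*-monoʳ-≤ 16 (1-mod-4⇒13≤ 2≤D squarefree D≢5 D%4≡)))
... | 0 = below-16D {D = D} (ℕP.<-≤-trans (from-yes (25 ℕ.<? 32)) (ℕP.*-monoʳ-≤ 16 2≤D))
... | suc (suc _) = below-16D {D = D} (ℕP.<-≤-trans (from-yes (25 ℕ.<? 32)) (ℕP.*-monoʳ-≤ 16 2≤D))

module PartitionCounting {D : ℕ} (2≤D : 2 ℕ.≤ D) (squarefree : SquareFree D) (D≢5 : D ≢ 5) (c c₂ : ℤ)
                         (c-ceiling : IsCeil D c (ξ D)) (c₂-ceiling : IsCeil D c₂ (+ 2 · ξ D)) where

  open Embedding D (squarefree⇒irrationalSqrt 2≤D squarefree) (δ D) (0≤δ' (D % 4)) (δ'-idempotent (D % 4)) public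
  open Interpretation c c₂ public
  open Partitions D (squarefree⇒irrationalSqrt 2≤D squarefree) (δ D) (0≤δ' (D % 4)) (δ'-idempotent (D % 4))
                  (D-large 2≤D squarefree D≢5) c c₂
  -- For d = δ D, Positive D x is IsPos x without the record wrapper.
  open SummandsOfα (pos (proj₁ c-ceiling) , proj₂ c-ceiling ∘ unpos) (pos (proj₁ c₂-ceiling) , proj₂ c₂-ceiling ∘ unpos) public

  partition : ∀ ss → sumOK (map ⟦_⟧ ss) ≡ α → IsPartition D α (map ⟦_⟧ ss)
  partition [] Σ≡α with () ← cong proj₂ Σ≡α
  partition (s ∷ ss) Σ≡α = AllP.map⁺ (All.universal (IsTotPos⇒PosSqrt ∘ IsTotPos-⟦⟧) (s ∷ ss)) , Σ≡α

  summands : ∀ {xs} → IsPartition D α xs → ∃ λ ss → xs ≡ map ⟦_⟧ ss × sumOK (map ⟦_⟧ ss) ≡ α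
  summands {x ∷ xs} (xs≫0 , Σ≡α) with summands-of-α (All.map PosSqrt⇒IsTotPos xs≫0) Σ≡α
  ... | ss , xs≡ss = ss , xs≡ss , subst (λ ys → sumOK ys ≡ α) xs≡ss Σ≡α

  count : ∀ {n} (reps : Fin n → List Summand) → (∀ i → sumOK (map ⟦_⟧ (reps i)) ≡ α) →
          (∀ i j → reps i ↭ reps j → i ≡ j) → (∀ ss → sumOK (map ⟦_⟧ ss) ≡ α → ∃ λ i → ss ↭ reps i) →
          PartitionCount D α n
  count {n} reps reps-sum reps-distinct reps-complete =
    tabulate P , (λ i → subst (IsPartition D α) (sym (lookup-P i)) (partition (reps i) (reps-sum i)))
               , (λ i j Pi↭Pj → reps-distinct i j (↭-map-reflect ⟦⟧-injective (subst₂ _↭_ (lookup-P i) (lookup-P j) Pi↭Pj)))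
               , complete
    where
    P : Fin n → List OK
    P i = map ⟦_⟧ (reps i)
    lookup-P : ∀ i → lookup (tabulate P) i ≡ P i
    lookup-P = lookup∘tabulate P
    complete : ∀ xs → IsPartition D α xs → ∃ λ i → xs ↭ lookup (tabulate P) i
    complete xs xs-partition with summands xs-partition
    ... | ss , xs≡ss , Σ≡α with reps-complete ss Σ≡α
    ...   | i , ss↭rep = i , subst₂ _↭_ (sym xs≡ss) (sym (lookup-P i)) (PermP.map⁺ ⟦_⟧ ss↭rep)

  count-case : ∀ {k} (c₂+2≡c+c+k : c₂ + + 2 ≡ c + c + + k) {r} (codes-ℓ₁ : Fin r → List Summand)
               (codes-ℓ₁-sum : ∀ j → sumOK (map ⟦_⟧ (codes-ℓ₁ j)) ≡ α)
               (enumerate-ℓ₁ : ∀ m₁ m₂ Z → m₁ ℕ.+ m₂ ℕ.+ ℓ₀-sum Z ≡ k → ∃ λ j → ℓ₁ m₁ ∷ ℓ₁ m₂ ∷ map ℓ₀ Z ↭ codes-ℓ₁ j) →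
               (∀ i j → codes codes-ℓ₁ i ↭ codes codes-ℓ₁ j → i ≡ j) → PartitionCount D α (4 ℕ.+ r)
  count-case c₂+2≡c+c+k codes-ℓ₁ codes-ℓ₁-sum enumerate-ℓ₁ distinct = count (codes codes-ℓ₁) codes-sum distinct codes-complete
    where open Codes c₂+2≡c+c+k codes-ℓ₁ codes-ℓ₁-sum enumerate-ℓ₁

-- Opened only now: above, ≤ is the order on ℤ.
open import Data.Nat using (_≤_)

theorem6p2 : (D : ℕ) → 2 ≤ D → SquareFree D → D ≢ 5 →
    (c c₂ : ℤ) → IsCeil D c (ξ D) → IsCeil D c₂ (+ 2 · ξ D) →
    (Positive D (ι (+ 2 Data.Integer.* c - + 1) ⊖ (+ 2 · ξ D)) → PartitionCount D (c₂ + + 2 , + 2) 6)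
    × (Positive D ((+ 2 · ξ D) ⊖ ι (+ 2 Data.Integer.* c - + 1)) → PartitionCount D (c₂ + + 2 , + 2) 9)
theorem6p2 D 2≤D squarefree D≢5 c c₂ c-ceiling c₂-ceiling = case-i , case-ii
  where
  open PartitionCounting 2≤D squarefree D≢5 c c₂ c-ceiling c₂-ceiling
  case-i : Positive D (ι (+ 2 ℤ.* c - + 1) ⊖ (+ 2 · ξ D)) → PartitionCount D α 6
  case-i 2ξ<2c-1 = count-case c₂+2≡2c+1 codes-ℓ₁¹ (codes-ℓ₁¹-sum c₂+2≡2c+1) enumerate-ℓ₁¹ codes-ℓ₁¹-distinct
    where
    c₂+2≡2c+1 : c₂ + + 2 ≡ c + c + + 1
    c₂+2≡2c+1 = ⌈2ξ⌉≡2⌈ξ⌉-1 (pos 2ξ<2c-1)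
  case-ii : Positive D ((+ 2 · ξ D) ⊖ ι (+ 2 ℤ.* c - + 1)) → PartitionCount D α 9
  case-ii 2ξ>2c-1 = count-case c₂+2≡2c+2 codes-ℓ₁² (codes-ℓ₁²-sum c₂+2≡2c+2) enumerate-ℓ₁² codes-ℓ₁²-distinct
    where
    c₂+2≡2c+2 : c₂ + + 2 ≡ c + c + + 2
    c₂+2≡2c+2 = ⌈2ξ⌉≡2⌈ξ⌉ (pos 2ξ>2c-1)
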